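{- Let $M$ be a closed term. Then $\mathcal{P}(M)=\sup\{\|\mathtt{a}\|\mid \text{there is a tight derivation of } \vdash^{w}M:\mathtt{a} \text{ for some } w\}$ and $\mathcal{E}(M)=\sup\{w\mid \text{there is a tight derivation of } \vdash^{w}M:\mathtt{a}\text{ for some }\mathtt{a}\}$.
   Context: Terms: values $V ::= x \mid \lambda x.M$; terms $M ::= V \mid VV \mid M\oplus M \mid \mathtt{let}\ x = M\ \mathtt{in}\ M$; $M\{V/x\}$ is capture-avoiding substitution. A multidistribution on terms is a finite multiset $\langle p_iM_i\rangle_{i\in I}$ with $p_i\in(0,1]$, $\sum_ip_i\le1$; $\sqcup$ is multiset union and $q\cdot\langle p_iM_i\rangle=\langle (qp_i)M_i\rangle$. One-step reduction: $(\lambda x.M)V\to\langle 1\,M\{V/x\}\rangle$; $\mathtt{let}\ x=V\ \mathtt{in}\ M\to\langle 1\,M\{V/x\}\rangle$; $M\oplus N\to\langle\tfrac12 M,\tfrac12 N\rangle$; if $N\to\langle p_iN_i\rangle_{i\in I}$ then $\mathtt{let}\ x=N\ \mathtt{in}\ M\to\langle p_i(\mathtt{let}\ x=N_i\ \mathtt{in}\ M)\rangle_{i\in I}$. Lifting to multidistributions of closed terms: $\langle p_iM_i\rangle_{i\in I}\Rightarrow\bigsqcup_i p_i\cdot\mathbf{m}_i$ where $\mathbf{m}_i=\langle 1M_i\rangle$ if $M_i$ is a value and $M_i\to\mathbf{m}_i$ otherwise. For closed $M$ let $\langle 1M\rangle=\mathbf{m}_0\Rightarrow\mathbf{m}_1\Rightarrow\cdots$;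 $\mathcal{P}_k(M)$ is the sum of the probabilities of the values occurring in $\mathbf{m}_k$; $\mathcal{P}(M)=\sup_k\mathcal{P}_k(M)$ (probability of termination); $\mathcal{E}_k(M)=\sum_{j=0}^{k-1}(1-\mathcal{P}_j(M))$ and $\mathcal{E}(M)=\sup_k\mathcal{E}_k(M)$ (expected runtime, possibly $\infty$). Types: arrow types $\mathtt{A} ::= \mathcal{M}\to \mathtt{a}$; intersection types $\mathcal{M} ::= [q_1\cdot \mathtt{A}_1,\dots,q_n\cdot\mathtt{A}_n]$ ($n\ge0$, scale factors $q_i\in(0,1]\cap\mathbb{Q}$); type distributions $\mathtt{a} ::= \langle p_1\mathcal{M}_1,\dots,p_n\mathcal{M}_n\rangle$ ($n\ge0$, $p_i\in(0,1]$, $\sum p_i\le1$), with norm $\|\mathtt{a}\|=\sum_i p_i$; $\mathbf{0}$ is the empty type distribution. Scaling: $u\cdot[q_i\cdot\mathtt{A}_i]_i=[(uq_i)\cdot \mathtt{A}_i]_i$, $u\cdot\langle p_i\mathcal{M}_i\rangle_i=\langle (up_i)\mathcal{M}_i\rangle_i$; $\uplus,\sqcup$ multiset unions. Typing contexts map variables to intersection types (finitely many nonempty), pointwise $\uplus$ and scaling. Rules for $\Gamma\vdash^{w}M:\tau$ ($w\in\mathbb{Q}$): (Var) $x:\mathcal{M}\vdash^0 x:\mathcal{M}$. (Zero) $\vdash^0 M:\mathbf{0}$. (@) from $\Gamma\vdash^{w}V:[1\cdot(\mathcal{M}\to\mathtt{b})]$, $\Delta\vdash^{v}W:\mathcal{M}$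 infer $\Gamma\uplus\Delta\vdash^{w+v}VW:\mathtt{b}$. ($\oplus$) from $\Gamma\vdash^{w}M:\mathtt{a}$, $\Delta\vdash^{v}N:\mathtt{b}$ infer $\tfrac12\cdot\Gamma\uplus\tfrac12\cdot\Delta\vdash^{\frac12 w+\frac12 v+1}M\oplus N:\tfrac12\mathtt{a}\sqcup\tfrac12\mathtt{b}$. ($\lambda$) from $\Gamma,x:\mathcal{M}\vdash^{w}M:\mathtt{b}$ infer $\Gamma\vdash^{w+1}\lambda x.M:\mathcal{M}\to\mathtt{b}$. (let) from $\Gamma\vdash^{v}N:\langle p_k\mathcal{M}_k\rangle_{k\in K}$ and $\Delta_k,x:\mathcal{M}_k\vdash^{w_k}M:\mathtt{b}_k$ ($k\in K$) infer $\Gamma\uplus_{k}p_k\cdot\Delta_k\vdash^{\sum_k p_kw_k+v+1}\mathtt{let}\ x=N\ \mathtt{in}\ M:\bigsqcup_k p_k\mathtt{b}_k$. (Val) from $\Gamma\vdash^{w}V:\mathcal{M}$ infer $\Gamma\vdash^{w}V:\langle 1\mathcal{M}\rangle$. (!) for finite possibly empty $I$, from $\Gamma_i\vdash^{w_i}V:\mathtt{A}_i$ and scale factors $q_i$ infer $\uplus_i q_i\cdot\Gamma_i\vdash^{\sum_i q_iw_i}V:[q_i\cdot\mathtt{A}_i]_{i\in I}$. A type distribution is tight if it has the form $\langle q_k[\,]\rangle_{k\in K}$ ($K$ possibly empty); a derivation of $\vdash^{w}M:\mathtt{a}$ (empty context) is tight if $\mathtt{a}$ is tight.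
   Formalization: The probabilities $p_i$ of type distributions, including those inside arrow and intersection types, are rational rather than arbitrary elements of (0,1]. -}

module Defs where

open import Data.Nat using (ℕ; zero; suc)
open import Data.Fin using (Fin; zero; suc)
open import Data.Rational using (ℚ; 0ℚ; 1ℚ; ½; _+_; _*_; _-_; _<_; _≤_)
open import Data.List using (List; []; _∷_; _++_; map; concatMap; foldr)
open import Data.List.Relation.Binary.Permutation.Propositional using (_↭_)
open import Data.List.Relation.Unary.All using (All)
open import Data.Vec using (Vec; []; _∷_; zipWith; replicate; _[_]≔_)
import Data.Vec as V
open import Data.Product using (_×_; _,_; Σ; ∃; proj₁; proj₂)
open import Relation.Binary.PropositionalEquality using (_≡_)

-- Terms (well-scoped de Bruijn syntax; Tm n = terms with n free vars)

mutual
  data Val (n : ℕ) : Set where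
    var : Fin n → Val n
    lam : Tm (suc n) → Val n            -- λx.M, x = index 0

  data Tm (n : ℕ) : Set where
    val  : Val n → Tm n
    app  : Val n → Val n → Tm n
    _⊕_  : Tm n → Tm n → Tm n
    lett : Tm n → Tm (suc n) → Tm n      -- let x = N in M  (lett N M)

mutual
  renV : ∀ {n m} → (Fin n → Fin m) → Val n → Val m
  renV ρ (var i) = var (ρ i)
  renV ρ (lam M) = lam (renT (extR ρ) M)

  renT : ∀ {n m} → (Fin n → Fin m) → Tm n → Tm m
  renT ρ (val V) = val (renV ρ V)
  renT ρ (app V W) = app (renV ρ V) (renV ρ W)
  renT ρ (M ⊕ N) = renT ρ M ⊕ renT ρ N
  renT ρ (lett N M) = lett (renT ρ N) (renT (extR ρ) M)

  extR : ∀ {n m} → (Fin n → Fin m) → Fin (suc n) → Fin (suc m)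
  extR ρ zero = zero
  extR ρ (suc i) = suc (ρ i)

mutual
  subV : ∀ {n m} → (Fin n → Val m) → Val n → Val m
  subV σ (var i) = σ i
  subV σ (lam M) = lam (subT (extS σ) M)

  subT : ∀ {n m} → (Fin n → Val m) → Tm n → Tm m
  subT σ (val V) = val (subV σ V)
  subT σ (app V W) = app (subV σ V) (subV σ W)
  subT σ (M ⊕ N) = subT σ M ⊕ subT σ N
  subT σ (lett N M) = lett (subT σ N) (subT (extS σ) M)

  extS : ∀ {n m} → (Fin n → Val m) → Fin (suc n) → Val (suc m)
  extS σ zero = var zero
  extS σ (suc i) = renV suc (σ i)

single : ∀ {n} → Val n → Fin (suc n) → Val n
single V zero = V
single V (suc i) = var i

-- M {V / x}, x being the variable bound at index 0
_[_] : ∀ {n} → Tm (suc n) → Val n → Tm n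
M [ V ] = subT (single V) M

sumℚ : List ℚ → ℚ
sumℚ = foldr _+_ 0ℚ

MDist : Set
MDist = List (ℚ × Tm 0)

scaleM : ℚ → MDist → MDist
scaleM q = map (λ { (p , M) → (q * p , M) })

-- 'lift1 M' is m with: m = ⟨1 M⟩ if M is a value, M → m otherwise.
-- (On closed terms one-step reduction is deterministic and total on
-- non-values; a closed value is always a λ-abstraction.)
lift1 : Tm 0 → MDist
lift1 (val V) = (1ℚ , val V) ∷ []
lift1 (app (var ()) W)
lift1 (app (lam M) W) = (1ℚ , M [ W ]) ∷ []
lift1 (M ⊕ N) = (½ , M) ∷ (½ , N) ∷ []
lift1 (lett (val V) M) = (1ℚ , M [ V ]) ∷ []
lift1 (lett (app V W) M) =
  map (λ { (p , N') → (p , lett N' M) }) (lift1 (app V W))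
lift1 (lett (N₁ ⊕ N₂) M) =
  map (λ { (p , N') → (p , lett N' M) }) (lift1 (N₁ ⊕ N₂))
lift1 (lett (lett N₁ N₂) M) =
  map (λ { (p , N') → (p , lett N' M) }) (lift1 (lett N₁ N₂))

stepM : MDist → MDist
stepM = concatMap (λ { (p , M) → scaleM p (lift1 M) })

mdist : ℕ → Tm 0 → MDist
mdist zero M = (1ℚ , M) ∷ []
mdist (suc k) M = stepM (mdist k M)

valProb : ℚ × Tm 0 → ℚ
valProb (p , val V) = p
valProb (p , app V W) = 0ℚ
valProb (p , M ⊕ N) = 0ℚ
valProb (p , lett N M) = 0ℚ

Pk : ℕ → Tm 0 → ℚ
Pk k M = sumℚ (map valProb (mdist k M))

Ek : ℕ → Tm 0 → ℚ
Ek zero M = 0ℚ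
Ek (suc k) M = Ek k M + (1ℚ - Pk k M)

-- Types.  Multisets are represented by lists; the typing relation is
-- closed under (deep) multiset equality via the conversion rules below.

data Arrow : Set where
  _⇒_ : List (ℚ × Arrow) → List (ℚ × List (ℚ × Arrow)) → Arrow

Inter : Set
Inter = List (ℚ × Arrow)

Dist : Set
Dist = List (ℚ × Inter)

‖_‖ : Dist → ℚ
‖ a ‖ = sumℚ (map proj₁ a)

scaleI : ℚ → Inter → Inter
scaleI u = map (λ { (q , A) → (u * q , A) })

scaleD : ℚ → Dist → Dist
scaleD u = map (λ { (p , 𝓜) → (u * p , 𝓜) })

InUnit : ℚ → Set
InUnit q = (0ℚ < q) × (q ≤ 1ℚ)

mutual
  data WFA : Arrow → Set where
    wf⇒ : ∀ {𝓜 a} → WFI 𝓜 → WFD a → WFA (𝓜 ⇒ a)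

  data WFI : Inter → Set where
    []  : WFI []
    _∷_ : ∀ {q A 𝓜} → InUnit q × WFA A → WFI 𝓜 → WFI ((q , A) ∷ 𝓜)

  data WFD' : Dist → Set where
    []  : WFD' []
    _∷_ : ∀ {p 𝓜 a} → InUnit p × WFI 𝓜 → WFD' a → WFD' ((p , 𝓜) ∷ a)

  data WFD : Dist → Set where
    wfd : ∀ {a} → WFD' a → ‖ a ‖ ≤ 1ℚ → WFD a

mutual
  data _≈A_ : Arrow → Arrow → Set where
    ≈⇒ : ∀ {𝓜 𝓜' a a'} → 𝓜 ≈I 𝓜' → a ≈D a' → (𝓜 ⇒ a) ≈A (𝓜' ⇒ a')

  data PwI : Inter → Inter → Set where
    []  : PwI [] []
    _∷_ : ∀ {q A A' 𝓜 𝓜'} → A ≈A A' → PwI 𝓜 𝓜' → PwI ((q , A) ∷ 𝓜) ((q , A') ∷ 𝓜')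

  data _≈I_ : Inter → Inter → Set where
    ≈I-intro : ∀ {𝓜 𝓝 𝓜'} → 𝓜 ↭ 𝓝 → PwI 𝓝 𝓜' → 𝓜 ≈I 𝓜'

  data PwD : Dist → Dist → Set where
    []  : PwD [] []
    _∷_ : ∀ {p 𝓜 𝓜' a a'} → 𝓜 ≈I 𝓜' → PwD a a' → PwD ((p , 𝓜) ∷ a) ((p , 𝓜') ∷ a')

  data _≈D_ : Dist → Dist → Set where
    ≈D-intro : ∀ {a b a'} → a ↭ b → PwD b a' → a ≈D a'

Ctx : ℕ → Set
Ctx n = Vec Inter n

∅ : ∀ {n} → Ctx n
∅ = replicate _ []

_⊎C_ : ∀ {n} → Ctx n → Ctx n → Ctx n
_⊎C_ = zipWith _++_

_·C_ : ∀ {n} → ℚ → Ctx n → Ctx n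
u ·C Γ = V.map (scaleI u) Γ

data _≈C_ : ∀ {n} → Ctx n → Ctx n → Set where
  []  : [] ≈C []
  _∷_ : ∀ {n 𝓜 𝓜'} {Γ Γ' : Ctx n} → 𝓜 ≈I 𝓜' → Γ ≈C Γ' → (𝓜 ∷ Γ) ≈C (𝓜' ∷ Γ')

mutual
  data _⊢A[_]_∶_ {n : ℕ} : Ctx n → ℚ → Val n → Arrow → Set where
    ⊢λ : ∀ {Γ 𝓜 w M b} → (𝓜 ∷ Γ) ⊢[ w ] M ∶ b → Γ ⊢A[ w + 1ℚ ] lam M ∶ (𝓜 ⇒ b)
    convA : ∀ {Γ Γ' w V A A'} → Γ ⊢A[ w ] V ∶ A → Γ ≈C Γ' → A ≈A A' →
            Γ' ⊢A[ w ] V ∶ A'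

  data _⊢I[_]_∶_ {n : ℕ} : Ctx n → ℚ → Val n → Inter → Set where
    ⊢var : ∀ {x 𝓜} → WFI 𝓜 → (∅ [ x ]≔ 𝓜) ⊢I[ 0ℚ ] var x ∶ 𝓜
    ⊢! : ∀ {Γ w V 𝓜} → Bang Γ w V 𝓜 → Γ ⊢I[ w ] V ∶ 𝓜
    convI : ∀ {Γ Γ' w V 𝓜 𝓜'} → Γ ⊢I[ w ] V ∶ 𝓜 → Γ ≈C Γ' → 𝓜 ≈I 𝓜' →
            Γ' ⊢I[ w ] V ∶ 𝓜'

  -- the finite family of premises of rule (!):
  -- Bang (⊎ᵢ qᵢ·Γᵢ) (Σᵢ qᵢwᵢ) V [qᵢ·Aᵢ]ᵢ
  data Bang {n : ℕ} : Ctx n → ℚ → Val n → Inter → Set where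
    []  : ∀ {V} → Bang ∅ 0ℚ V []
    cons : ∀ {Γ Γ' w w' V A 𝓜} (q : ℚ) → InUnit q →
           Γ ⊢A[ w ] V ∶ A → Bang Γ' w' V 𝓜 →
           Bang ((q ·C Γ) ⊎C Γ') (q * w + w') V ((q , A) ∷ 𝓜)

  data _⊢[_]_∶_ {n : ℕ} : Ctx n → ℚ → Tm n → Dist → Set where
    ⊢zero : ∀ {M} → ∅ ⊢[ 0ℚ ] M ∶ []
    ⊢app : ∀ {Γ Δ w v V W 𝓜 b} → Γ ⊢I[ w ] V ∶ ((1ℚ , (𝓜 ⇒ b)) ∷ []) →
         Δ ⊢I[ v ] W ∶ 𝓜 → (Γ ⊎C Δ) ⊢[ w + v ] app V W ∶ b
    ⊢⊕ : ∀ {Γ Δ w v M N a b} → Γ ⊢[ w ] M ∶ a → Δ ⊢[ v ] N ∶ b →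
         ((½ ·C Γ) ⊎C (½ ·C Δ)) ⊢[ ½ * w + ½ * v + 1ℚ ] (M ⊕ N) ∶
           (scaleD ½ a ++ scaleD ½ b)
    ⊢let : ∀ {Γ Δ v w N M a b} → Γ ⊢[ v ] N ∶ a → LetBodies M a Δ w b →
           (Γ ⊎C Δ) ⊢[ w + v + 1ℚ ] lett N M ∶ b
    ⊢val : ∀ {Γ w V 𝓜} → Γ ⊢I[ w ] V ∶ 𝓜 → Γ ⊢[ w ] val V ∶ ((1ℚ , 𝓜) ∷ [])
    convT : ∀ {Γ Γ' w M a a'} → Γ ⊢[ w ] M ∶ a → Γ ≈C Γ' → a ≈D a' →
            Γ' ⊢[ w ] M ∶ a'

  -- the family of body premises of rule (let) for N : ⟨pₖ𝓜ₖ⟩ₖ: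
  -- LetBodies M ⟨pₖ𝓜ₖ⟩ₖ (⊎ₖ pₖ·Δₖ) (Σₖ pₖwₖ) (⊔ₖ pₖbₖ)
  data LetBodies {n : ℕ} (M : Tm (suc n)) : Dist → Ctx n → ℚ → Dist → Set where
    []  : LetBodies M [] ∅ 0ℚ []
    cons : ∀ {p 𝓜 a Δ Δ' w w' b b'} → (𝓜 ∷ Δ) ⊢[ w ] M ∶ b →
           LetBodies M a Δ' w' b' →
           LetBodies M ((p , 𝓜) ∷ a) ((p ·C Δ) ⊎C Δ') (p * w + w') (scaleD p b ++ b')

Tight : Dist → Set
Tight a = All (λ pm → proj₂ pm ≡ []) a

-- Equality of suprema (in [−∞,+∞]) of two sets of rationals, without reals:
-- sup S ≤ sup T  iff  every rational r strictly below some element of S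
-- is strictly below some element of T.
SupLe : (ℚ → Set) → (ℚ → Set) → Set
SupLe S T = ∀ x → S x → ∀ r → r < x → ∃ λ y → T y × (r < y)

SameSup : (ℚ → Set) → (ℚ → Set) → Set
SameSup S T = SupLe S T × SupLe T S

-- {𝒫_k(M) | k}  (sup = 𝒫(M)) and {ℰ_k(M) | k}  (sup = ℰ(M))
PSeq : Tm 0 → ℚ → Set
PSeq M r = ∃ λ k → Pk k M ≡ r

ESeq : Tm 0 → ℚ → Set
ESeq M r = ∃ λ k → Ek k M ≡ r

TightNorms : Tm 0 → ℚ → Set
TightNorms M r = ∃ λ w → ∃ λ a → Tight a × ([] ⊢[ w ] M ∶ a) × (‖ a ‖ ≡ r)

TightWeights : Tm 0 → ℚ → Set
TightWeights M r = ∃ λ a → Tight a × ([] ⊢[ r ] M ∶ a)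

-- Soundness is proved by a quantitative realizability (logical-relations) argument:
-- a closed derivation of weight w and type a is realized by the reduction sequence,
-- in that after some number of steps the runtime already spent plus the weight still
-- predicted by the values reached is at least w, and those values carry total mass ‖ a ‖.
-- Tight types predict no further work, which yields ‖ a ‖ ≤ 𝒫ₖ(M) and w ≤ ℰₖ(M).
--
-- Completeness types the multidistribution reached after k steps tightly, each value by
-- ⟨1 [ ]⟩ and everything else by the empty type distribution, and expands this family of
-- derivations backwards one step at a time (subject expansion, using anti-substitution for
-- β and let-β); each step adds to the weight the mass of the non-values it reduces.

module Submission where

open import Defs
open import Data.Nat using (ℕ; zero; suc; z≤n; s≤s) renaming (_+_ to _+ℕ_)
import Data.Nat.Properties as ℕ
open import Data.Fin using (Fin; zero; suc)
open import Data.Integer using (+≤+)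
open import Data.Rational
  using (ℚ; 0ℚ; 1ℚ; ½; _+_; _*_; _-_; -_; _≤_; *≤*; positive; nonNegative)
open import Data.Rational.Properties
open import Data.List using (List; []; _∷_; _++_; map)
import Data.List.Properties as List
open import Data.List.Relation.Binary.Permutation.Propositional
  using (_↭_; ↭-sym; ↭-reflexive; ↭⇒↭ₛ)
  renaming (refl to ↭-refl; prep to ↭-prep; swap to ↭-swap; trans to ↭-trans)
open import Data.List.Relation.Binary.Permutation.Propositional.Properties
  using (++⁺; ++⁺ˡ; shifts; map⁺; All-resp-↭; ↭-empty-inv)
open import Data.List.Relation.Binary.Permutation.Setoid.Properties using (foldr-commMonoid)
open import Data.List.Relation.Unary.All using (All; []; _∷_)
open import Data.Vec using ([]; _∷_; _[_]≔_)
open import Data.Product using (_×_; _,_; Σ; proj₁; proj₂)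
open import Data.Sum using (_⊎_; inj₁; inj₂)
open import Data.Unit using (⊤; tt)
open import Data.Empty using (⊥; ⊥-elim)
open import Function using (_∘_)
open import Level using (0ℓ)
open import Relation.Nullary.Decidable using (dec⇒maybe)
open import Relation.Binary.PropositionalEquality
  using (_≡_; refl; sym; trans; cong; cong₂; subst; subst₂; _≗_; module ≡-Reasoning; setoid)
open import Relation.Binary.Construct.Closure.ReflexiveTransitive
  using (Star; ε; _◅_; _◅◅_; gmap; reverse)
open import Relation.Binary.Construct.Closure.ReflexiveTransitive.Properties
  using () renaming (reflexive to ≡⇒Star)
open import Tactic.RingSolver using (solve-∀)
open import Tactic.RingSolver.Core.AlmostCommutativeRing
  using (AlmostCommutativeRing; fromCommutativeRing)

ringℚ : AlmostCommutativeRing 0ℓ 0ℓ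
ringℚ = fromCommutativeRing +-*-commutativeRing (λ x → dec⇒maybe (0ℚ ≟ x))

+-interchange : ∀ a b c d → (a + b) + (c + d) ≡ (a + c) + (b + d)
+-interchange = solve-∀ ringℚ

+-exchange : ∀ a b c → a + (b + c) ≡ b + (a + c)
+-exchange = solve-∀ ringℚ

*-+-assoc : ∀ p q w W → (p * q) * w + p * W ≡ p * (q * w + W)
*-+-assoc = solve-∀ ringℚ

+-cancelʳ : ∀ x a → (x + a) - a ≡ x
+-cancelʳ = solve-∀ ringℚ

*-monoˡ-≤-nonNeg′ : ∀ {p x y} → 0ℚ ≤ p → x ≤ y → p * x ≤ p * y
*-monoˡ-≤-nonNeg′ {p} 0≤p = *-monoˡ-≤-nonNeg p {{nonNegative 0≤p}}

nonNeg*nonNeg : ∀ {p q} → 0ℚ ≤ p → 0ℚ ≤ q → 0ℚ ≤ p * q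
nonNeg*nonNeg {p} {q} 0≤p 0≤q = subst (_≤ p * q) (*-zeroʳ p) (*-monoˡ-≤-nonNeg′ 0≤p 0≤q)

nonNeg*nonPos : ∀ {p q} → 0ℚ ≤ p → q ≤ 0ℚ → p * q ≤ 0ℚ
nonNeg*nonPos {p} {q} 0≤p q≤0 = subst (p * q ≤_) (*-zeroʳ p) (*-monoˡ-≤-nonNeg′ 0≤p q≤0)

≤-respʳ-≡ : ∀ {x y z} → x ≤ y → y ≡ z → x ≤ z
≤-respʳ-≡ x≤y refl = x≤y

≤-respˡ-≡ : ∀ {x y z} → x ≡ y → y ≤ z → x ≤ z
≤-respˡ-≡ refl y≤z = y≤z

0≤½ : 0ℚ ≤ ½
0≤½ = *≤* (+≤+ z≤n)

0≤1 : 0ℚ ≤ 1ℚ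
0≤1 = *≤* (+≤+ z≤n)

sumℚ-++ : ∀ xs ys → sumℚ (xs ++ ys) ≡ sumℚ xs + sumℚ ys
sumℚ-++ [] ys = sym (+-identityˡ _)
sumℚ-++ (x ∷ xs) ys = trans (cong (x +_) (sumℚ-++ xs ys)) (sym (+-assoc x _ _))

sumℚ-↭ : ∀ {xs ys} → xs ↭ ys → sumℚ xs ≡ sumℚ ys
sumℚ-↭ p = foldr-commMonoid (setoid ℚ) +-0-isCommutativeMonoid (↭⇒↭ₛ p)

module _ {A : Set} where

  scale : ℚ → List (ℚ × A) → List (ℚ × A)
  scale u = map (λ (q , x) → (u * q , x))

  mass : List (ℚ × A) → ℚ
  mass xs = sumℚ (map proj₁ xs)

  NonNeg : List (ℚ × A) → Set
  NonNeg = All (λ e → 0ℚ ≤ proj₁ e)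

  scale-scale : ∀ p q xs → scale p (scale q xs) ≡ scale (p * q) xs
  scale-scale p q [] = refl
  scale-scale p q ((r , x) ∷ xs) = cong₂ _∷_ (cong (_, x) (sym (*-assoc p q r))) (scale-scale p q xs)

  scale-1 : ∀ xs → scale 1ℚ xs ≡ xs
  scale-1 [] = refl
  scale-1 ((r , x) ∷ xs) = cong₂ _∷_ (cong (_, x) (*-identityˡ r)) (scale-1 xs)

  scale-++ : ∀ u xs ys → scale u (xs ++ ys) ≡ scale u xs ++ scale u ys
  scale-++ u = List.map-++ _

  mass-++ : ∀ xs ys → mass (xs ++ ys) ≡ mass xs + mass ys
  mass-++ xs ys = trans (cong sumℚ (List.map-++ proj₁ xs ys)) (sumℚ-++ (map proj₁ xs) (map proj₁ ys))

  mass-scale : ∀ u xs → mass (scale u xs) ≡ u * mass xs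
  mass-scale u [] = sym (*-zeroʳ u)
  mass-scale u ((q , x) ∷ xs) = trans (cong (u * q +_) (mass-scale u xs)) (sym (*-distribˡ-+ u q _))

  mass-↭ : ∀ {xs ys} → xs ↭ ys → mass xs ≡ mass ys
  mass-↭ p = sumℚ-↭ (map⁺ proj₁ p)

  NonNeg-++ : ∀ {xs ys} → NonNeg xs → NonNeg ys → NonNeg (xs ++ ys)
  NonNeg-++ [] h₂ = h₂
  NonNeg-++ (x ∷ h₁) h₂ = x ∷ NonNeg-++ h₁ h₂

  NonNeg-scale : ∀ {p xs} → 0ℚ ≤ p → NonNeg xs → NonNeg (scale p xs)
  NonNeg-scale hp [] = []
  NonNeg-scale hp (x ∷ h) = nonNeg*nonNeg hp x ∷ NonNeg-scale hp h

-- Substitution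

extR-cong : ∀ {n m} {ρ ρ' : Fin n → Fin m} → ρ ≗ ρ' → extR ρ ≗ extR ρ'
extR-cong e zero = refl
extR-cong e (suc i) = cong suc (e i)

extR-∘ : ∀ {n m k} (ρ : Fin m → Fin k) (ρ' : Fin n → Fin m) → extR ρ ∘ extR ρ' ≗ extR (ρ ∘ ρ')
extR-∘ ρ ρ' zero = refl
extR-∘ ρ ρ' (suc i) = refl

mutual
  renV-cong : ∀ {n m} {ρ ρ' : Fin n → Fin m} → ρ ≗ ρ' → ∀ V → renV ρ V ≡ renV ρ' V
  renV-cong e (var i) = cong var (e i)
  renV-cong e (lam M) = cong lam (renT-cong (extR-cong e) M)

  renT-cong : ∀ {n m} {ρ ρ' : Fin n → Fin m} → ρ ≗ ρ' → ∀ M → renT ρ M ≡ renT ρ' M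
  renT-cong e (val V) = cong val (renV-cong e V)
  renT-cong e (app V W) = cong₂ app (renV-cong e V) (renV-cong e W)
  renT-cong e (M ⊕ N) = cong₂ _⊕_ (renT-cong e M) (renT-cong e N)
  renT-cong e (lett N M) = cong₂ lett (renT-cong e N) (renT-cong (extR-cong e) M)

extS-cong : ∀ {n m} {σ σ' : Fin n → Val m} → σ ≗ σ' → extS σ ≗ extS σ'
extS-cong e zero = refl
extS-cong e (suc i) = cong (renV suc) (e i)

mutual
  subV-cong : ∀ {n m} {σ σ' : Fin n → Val m} → σ ≗ σ' → ∀ V → subV σ V ≡ subV σ' V
  subV-cong e (var i) = e i
  subV-cong e (lam M) = cong lam (subT-cong (extS-cong e) M)

  subT-cong : ∀ {n m} {σ σ' : Fin n → Val m} → σ ≗ σ' → ∀ M → subT σ M ≡ subT σ' M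
  subT-cong e (val V) = cong val (subV-cong e V)
  subT-cong e (app V W) = cong₂ app (subV-cong e V) (subV-cong e W)
  subT-cong e (M ⊕ N) = cong₂ _⊕_ (subT-cong e M) (subT-cong e N)
  subT-cong e (lett N M) = cong₂ lett (subT-cong e N) (subT-cong (extS-cong e) M)

mutual
  renV-renV : ∀ {n m k} (ρ : Fin m → Fin k) (ρ' : Fin n → Fin m) V →
              renV ρ (renV ρ' V) ≡ renV (ρ ∘ ρ') V
  renV-renV ρ ρ' (var i) = refl
  renV-renV ρ ρ' (lam M) =
    cong lam (trans (renT-renT (extR ρ) (extR ρ') M) (renT-cong (extR-∘ ρ ρ') M))

  renT-renT : ∀ {n m k} (ρ : Fin m → Fin k) (ρ' : Fin n → Fin m) M →
              renT ρ (renT ρ' M) ≡ renT (ρ ∘ ρ') M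
  renT-renT ρ ρ' (val V) = cong val (renV-renV ρ ρ' V)
  renT-renT ρ ρ' (app V W) = cong₂ app (renV-renV ρ ρ' V) (renV-renV ρ ρ' W)
  renT-renT ρ ρ' (M ⊕ N) = cong₂ _⊕_ (renT-renT ρ ρ' M) (renT-renT ρ ρ' N)
  renT-renT ρ ρ' (lett N M) =
    cong₂ lett (renT-renT ρ ρ' N) (trans (renT-renT (extR ρ) (extR ρ') M) (renT-cong (extR-∘ ρ ρ') M))

extS-extR : ∀ {n m k} (σ : Fin m → Val k) (ρ : Fin n → Fin m) → extS σ ∘ extR ρ ≗ extS (σ ∘ ρ)
extS-extR σ ρ zero = refl
extS-extR σ ρ (suc i) = refl

mutual
  subV-renV : ∀ {n m k} (σ : Fin m → Val k) (ρ : Fin n → Fin m) V →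
              subV σ (renV ρ V) ≡ subV (σ ∘ ρ) V
  subV-renV σ ρ (var i) = refl
  subV-renV σ ρ (lam M) =
    cong lam (trans (subT-renT (extS σ) (extR ρ) M) (subT-cong (extS-extR σ ρ) M))

  subT-renT : ∀ {n m k} (σ : Fin m → Val k) (ρ : Fin n → Fin m) M →
              subT σ (renT ρ M) ≡ subT (σ ∘ ρ) M
  subT-renT σ ρ (val V) = cong val (subV-renV σ ρ V)
  subT-renT σ ρ (app V W) = cong₂ app (subV-renV σ ρ V) (subV-renV σ ρ W)
  subT-renT σ ρ (M ⊕ N) = cong₂ _⊕_ (subT-renT σ ρ M) (subT-renT σ ρ N)
  subT-renT σ ρ (lett N M) =
    cong₂ lett (subT-renT σ ρ N) (trans (subT-renT (extS σ) (extR ρ) M) (subT-cong (extS-extR σ ρ) M))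

extR-extS : ∀ {n m k} (ρ : Fin m → Fin k) (σ : Fin n → Val m) →
            renV (extR ρ) ∘ extS σ ≗ extS (renV ρ ∘ σ)
extR-extS ρ σ zero = refl
extR-extS ρ σ (suc i) = trans (renV-renV (extR ρ) suc (σ i)) (sym (renV-renV suc ρ (σ i)))

mutual
  renV-subV : ∀ {n m k} (ρ : Fin m → Fin k) (σ : Fin n → Val m) V →
              renV ρ (subV σ V) ≡ subV (renV ρ ∘ σ) V
  renV-subV ρ σ (var i) = refl
  renV-subV ρ σ (lam M) =
    cong lam (trans (renT-subT (extR ρ) (extS σ) M) (subT-cong (extR-extS ρ σ) M))

  renT-subT : ∀ {n m k} (ρ : Fin m → Fin k) (σ : Fin n → Val m) M →
              renT ρ (subT σ M) ≡ subT (renV ρ ∘ σ) M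
  renT-subT ρ σ (val V) = cong val (renV-subV ρ σ V)
  renT-subT ρ σ (app V W) = cong₂ app (renV-subV ρ σ V) (renV-subV ρ σ W)
  renT-subT ρ σ (M ⊕ N) = cong₂ _⊕_ (renT-subT ρ σ M) (renT-subT ρ σ N)
  renT-subT ρ σ (lett N M) =
    cong₂ lett (renT-subT ρ σ N) (trans (renT-subT (extR ρ) (extS σ) M) (subT-cong (extR-extS ρ σ) M))

extS-extS : ∀ {n m k} (τ : Fin m → Val k) (σ : Fin n → Val m) →
            subV (extS τ) ∘ extS σ ≗ extS (subV τ ∘ σ)
extS-extS τ σ zero = refl
extS-extS τ σ (suc i) = trans (subV-renV (extS τ) suc (σ i)) (sym (renV-subV suc τ (σ i)))

mutual
  subV-subV : ∀ {n m k} (τ : Fin m → Val k) (σ : Fin n → Val m) V →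
              subV τ (subV σ V) ≡ subV (subV τ ∘ σ) V
  subV-subV τ σ (var i) = refl
  subV-subV τ σ (lam M) =
    cong lam (trans (subT-subT (extS τ) (extS σ) M) (subT-cong (extS-extS τ σ) M))

  subT-subT : ∀ {n m k} (τ : Fin m → Val k) (σ : Fin n → Val m) M →
              subT τ (subT σ M) ≡ subT (subV τ ∘ σ) M
  subT-subT τ σ (val V) = cong val (subV-subV τ σ V)
  subT-subT τ σ (app V W) = cong₂ app (subV-subV τ σ V) (subV-subV τ σ W)
  subT-subT τ σ (M ⊕ N) = cong₂ _⊕_ (subT-subT τ σ M) (subT-subT τ σ N)
  subT-subT τ σ (lett N M) =
    cong₂ lett (subT-subT τ σ N) (trans (subT-subT (extS τ) (extS σ) M) (subT-cong (extS-extS τ σ) M))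

extS-id : ∀ {n} {σ : Fin n → Val n} → σ ≗ var → extS σ ≗ var
extS-id e zero = refl
extS-id e (suc i) = cong (renV suc) (e i)

mutual
  subV-id : ∀ {n} {σ : Fin n → Val n} → σ ≗ var → ∀ V → subV σ V ≡ V
  subV-id e (var i) = e i
  subV-id e (lam M) = cong lam (subT-id (extS-id e) M)

  subT-id : ∀ {n} {σ : Fin n → Val n} → σ ≗ var → ∀ M → subT σ M ≡ M
  subT-id e (val V) = cong val (subV-id e V)
  subT-id e (app V W) = cong₂ app (subV-id e V) (subV-id e W)
  subT-id e (M ⊕ N) = cong₂ _⊕_ (subT-id e M) (subT-id e N)
  subT-id e (lett N M) = cong₂ lett (subT-id e N) (subT-id (extS-id e) M)

_∷ₛ_ : ∀ {n} → Val 0 → (Fin n → Val 0) → Fin (suc n) → Val 0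
(W ∷ₛ σ) zero = W
(W ∷ₛ σ) (suc i) = σ i

subT-extS-[] : ∀ {n} (σ : Fin n → Val 0) (W : Val 0) (M : Tm (suc n)) →
               subT (extS σ) M [ W ] ≡ subT (W ∷ₛ σ) M
subT-extS-[] σ W M = trans (subT-subT (single W) (extS σ) M) (subT-cong single-extS M)
  where
  single-extS : subV (single W) ∘ extS σ ≗ (W ∷ₛ σ)
  single-extS zero = refl
  single-extS (suc i) = trans (subV-renV (single W) suc (σ i)) (subV-id (λ _ → refl) (σ i))

subT-closed : (σ : Fin 0 → Val 0) (M : Tm 0) → subT σ M ≡ M
subT-closed σ = subT-id (λ ())

-- Dynamics of multidistributions

steps : ℕ → MDist → MDist
steps zero L = L
steps (suc k) L = stepM (steps k L)

mdist-steps : ∀ k M → mdist k M ≡ steps k ((1ℚ , M) ∷ [])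
mdist-steps zero M = refl
mdist-steps (suc k) M = cong stepM (mdist-steps k M)

stepM-++ : ∀ L₁ L₂ → stepM (L₁ ++ L₂) ≡ stepM L₁ ++ stepM L₂
stepM-++ [] L₂ = refl
stepM-++ ((p , M) ∷ L₁) L₂ =
  trans (cong (scaleM p (lift1 M) ++_) (stepM-++ L₁ L₂))
        (sym (List.++-assoc (scaleM p (lift1 M)) (stepM L₁) (stepM L₂)))

steps-++ : ∀ k L₁ L₂ → steps k (L₁ ++ L₂) ≡ steps k L₁ ++ steps k L₂
steps-++ zero L₁ L₂ = refl
steps-++ (suc k) L₁ L₂ = trans (cong stepM (steps-++ k L₁ L₂)) (stepM-++ (steps k L₁) (steps k L₂))

steps-suc : ∀ k L → steps (suc k) L ≡ steps k (stepM L)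
steps-suc zero L = refl
steps-suc (suc k) L = cong stepM (steps-suc k L)

stepM-scaleM : ∀ p L → stepM (scaleM p L) ≡ scaleM p (stepM L)
stepM-scaleM p [] = refl
stepM-scaleM p ((q , M) ∷ L) =
  trans (cong₂ _++_ (sym (scale-scale p q (lift1 M))) (stepM-scaleM p L))
        (sym (scale-++ p (scaleM q (lift1 M)) (stepM L)))

steps-scaleM : ∀ k p L → steps k (scaleM p L) ≡ scaleM p (steps k L)
steps-scaleM zero p L = refl
steps-scaleM (suc k) p L = trans (cong stepM (steps-scaleM k p L)) (stepM-scaleM p (steps k L))

steps-↭ : ∀ k {L₁ L₂} → L₁ ↭ L₂ → steps k L₁ ↭ steps k L₂
steps-↭ zero q = q
steps-↭ (suc k) q = stepM-↭ (steps-↭ k q)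
  where
  stepM-↭ : ∀ {L₁ L₂} → L₁ ↭ L₂ → stepM L₁ ↭ stepM L₂
  stepM-↭ ↭-refl = ↭-refl
  stepM-↭ (↭-prep (p , M) q) = ++⁺ˡ (scaleM p (lift1 M)) (stepM-↭ q)
  stepM-↭ (↭-swap (p , M) (p' , M') q) =
    ↭-trans (shifts (scaleM p (lift1 M)) (scaleM p' (lift1 M')))
            (++⁺ˡ (scaleM p' (lift1 M')) (++⁺ˡ (scaleM p (lift1 M)) (stepM-↭ q)))
  stepM-↭ (↭-trans q q') = ↭-trans (stepM-↭ q) (stepM-↭ q')

nonvalProb : ℚ × Tm 0 → ℚ
nonvalProb (p , val V) = 0ℚ
nonvalProb (p , app V W) = p
nonvalProb (p , M ⊕ N) = p
nonvalProb (p , lett N M) = p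

valMass nonvalMass : MDist → ℚ
valMass L = sumℚ (map valProb L)
nonvalMass L = sumℚ (map nonvalProb L)

module _ (f : ℚ × Tm 0 → ℚ) where

  sumMap-++ : ∀ L₁ L₂ → sumℚ (map f (L₁ ++ L₂)) ≡ sumℚ (map f L₁) + sumℚ (map f L₂)
  sumMap-++ L₁ L₂ = trans (cong sumℚ (List.map-++ f L₁ L₂)) (sumℚ-++ (map f L₁) (map f L₂))

  sumMap-↭ : ∀ {L₁ L₂} → L₁ ↭ L₂ → sumℚ (map f L₁) ≡ sumℚ (map f L₂)
  sumMap-↭ p = sumℚ-↭ (map⁺ f p)

  sumMap-scaleM : (∀ p q M → f (p * q , M) ≡ p * f (q , M)) →
                  ∀ p L → sumℚ (map f (scaleM p L)) ≡ p * sumℚ (map f L)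
  sumMap-scaleM f-hom p [] = sym (*-zeroʳ p)
  sumMap-scaleM f-hom p ((q , M) ∷ L) =
    trans (cong₂ _+_ (f-hom p q M) (sumMap-scaleM f-hom p L)) (sym (*-distribˡ-+ p _ _))

nonvalMass-scaleM : ∀ p L → nonvalMass (scaleM p L) ≡ p * nonvalMass L
nonvalMass-scaleM = sumMap-scaleM nonvalProb hom
  where
  hom : ∀ p q M → nonvalProb (p * q , M) ≡ p * nonvalProb (q , M)
  hom p q (val V) = sym (*-zeroʳ p)
  hom p q (app V W) = refl
  hom p q (M ⊕ N) = refl
  hom p q (lett N M) = refl

nonvalMass+valMass : ∀ L → nonvalMass L + valMass L ≡ mass L
nonvalMass+valMass [] = +-identityˡ 0ℚ
nonvalMass+valMass ((p , M) ∷ L) =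
  trans (+-interchange (nonvalProb (p , M)) (nonvalMass L) (valProb (p , M)) (valMass L))
        (cong₂ _+_ (split M) (nonvalMass+valMass L))
  where
  split : ∀ M → nonvalProb (p , M) + valProb (p , M) ≡ p
  split (val V) = +-identityˡ p
  split (app V W) = +-identityʳ p
  split (M ⊕ N) = +-identityʳ p
  split (lett N M) = +-identityʳ p

letE : Tm 1 → ℚ × Tm 0 → ℚ × Tm 0
letE M (p , N) = (p , lett N M)

NonNeg-letE : ∀ {L} (M : Tm 1) → NonNeg L → NonNeg (map (letE M) L)
NonNeg-letE M [] = []
NonNeg-letE M (x ∷ h) = x ∷ NonNeg-letE M h

mass-letE : ∀ L (M : Tm 1) → mass (map (letE M) L) ≡ mass L
mass-letE [] M = refl
mass-letE ((p , N) ∷ L) M = cong (p +_) (mass-letE L M)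

NonNeg-lift1 : ∀ M → NonNeg (lift1 M)
NonNeg-lift1 (val V) = 0≤1 ∷ []
NonNeg-lift1 (app (var ()) W)
NonNeg-lift1 (app (lam M) W) = 0≤1 ∷ []
NonNeg-lift1 (M ⊕ N) = 0≤½ ∷ 0≤½ ∷ []
NonNeg-lift1 (lett (val V) M) = 0≤1 ∷ []
NonNeg-lift1 (lett (app V W) M) = NonNeg-letE M (NonNeg-lift1 (app V W))
NonNeg-lift1 (lett (N₁ ⊕ N₂) M) = NonNeg-letE M (NonNeg-lift1 (N₁ ⊕ N₂))
NonNeg-lift1 (lett (lett N₁ N₂) M) = NonNeg-letE M (NonNeg-lift1 (lett N₁ N₂))

mass-lift1 : ∀ M → mass (lift1 M) ≡ 1ℚ
mass-lift1 (val V) = refl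
mass-lift1 (app (var ()) W)
mass-lift1 (app (lam M) W) = refl
mass-lift1 (M ⊕ N) = refl
mass-lift1 (lett (val V) M) = refl
mass-lift1 (lett (app V W) M) = trans (mass-letE (lift1 (app V W)) M) (mass-lift1 (app V W))
mass-lift1 (lett (N₁ ⊕ N₂) M) = trans (mass-letE (lift1 (N₁ ⊕ N₂)) M) (mass-lift1 (N₁ ⊕ N₂))
mass-lift1 (lett (lett N₁ N₂) M) = trans (mass-letE (lift1 (lett N₁ N₂)) M) (mass-lift1 (lett N₁ N₂))

NonNeg-stepM : ∀ {L} → NonNeg L → NonNeg (stepM L)
NonNeg-stepM {[]} [] = []
NonNeg-stepM {(p , M) ∷ L} (x ∷ h) = NonNeg-++ (NonNeg-scale x (NonNeg-lift1 M)) (NonNeg-stepM h)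

NonNeg-steps : ∀ k {L} → NonNeg L → NonNeg (steps k L)
NonNeg-steps zero h = h
NonNeg-steps (suc k) h = NonNeg-stepM (NonNeg-steps k h)

mass-stepM : ∀ L → mass (stepM L) ≡ mass L
mass-stepM [] = refl
mass-stepM ((p , M) ∷ L) =
  trans (mass-++ (scaleM p (lift1 M)) (stepM L))
        (cong₂ _+_ (trans (mass-scale p (lift1 M)) (trans (cong (p *_) (mass-lift1 M)) (*-identityʳ p)))
                   (mass-stepM L))

mass-steps : ∀ k L → mass (steps k L) ≡ mass L
mass-steps zero L = refl
mass-steps (suc k) L = trans (mass-stepM (steps k L)) (mass-steps k L)

nonvalProb-nonNeg : ∀ p M → 0ℚ ≤ p → 0ℚ ≤ nonvalProb (p , M)
nonvalProb-nonNeg p (val V) h = ≤-refl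
nonvalProb-nonNeg p (app V W) h = h
nonvalProb-nonNeg p (M ⊕ N) h = h
nonvalProb-nonNeg p (lett N M) h = h

valProb-nonNeg : ∀ p M → 0ℚ ≤ p → 0ℚ ≤ valProb (p , M)
valProb-nonNeg p (val V) h = h
valProb-nonNeg p (app V W) h = ≤-refl
valProb-nonNeg p (M ⊕ N) h = ≤-refl
valProb-nonNeg p (lett N M) h = ≤-refl

nonvalMass-nonNeg : ∀ {L} → NonNeg L → 0ℚ ≤ nonvalMass L
nonvalMass-nonNeg {[]} [] = ≤-refl
nonvalMass-nonNeg {(p , M) ∷ L} (x ∷ h) = +-mono-≤ (nonvalProb-nonNeg p M x) (nonvalMass-nonNeg h)

-- ℰₖ for an arbitrary multidistribution: each step costs the mass of the non-values it reduces.
runtime : ℕ → MDist → ℚ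
runtime zero L = 0ℚ
runtime (suc k) L = nonvalMass L + runtime k (stepM L)

runtime-suc : ∀ k L → runtime (suc k) L ≡ runtime k L + nonvalMass (steps k L)
runtime-suc zero L = trans (+-identityʳ (nonvalMass L)) (sym (+-identityˡ (nonvalMass L)))
runtime-suc (suc k) L =
  trans (cong (nonvalMass L +_)
          (trans (runtime-suc k (stepM L)) (cong (λ L' → runtime k (stepM L) + nonvalMass L') (sym (steps-suc k L)))))
        (sym (+-assoc (nonvalMass L) _ _))

runtime-++ : ∀ k L₁ L₂ → runtime k (L₁ ++ L₂) ≡ runtime k L₁ + runtime k L₂
runtime-++ zero L₁ L₂ = sym (+-identityˡ 0ℚ)
runtime-++ (suc k) L₁ L₂ =
  trans (cong₂ _+_ (sumMap-++ nonvalProb L₁ L₂)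
                   (trans (cong (runtime k) (stepM-++ L₁ L₂)) (runtime-++ k (stepM L₁) (stepM L₂))))
        (+-interchange (nonvalMass L₁) (nonvalMass L₂) _ _)

runtime-scaleM : ∀ k p L → runtime k (scaleM p L) ≡ p * runtime k L
runtime-scaleM zero p L = sym (*-zeroʳ p)
runtime-scaleM (suc k) p L =
  trans (cong₂ _+_ (nonvalMass-scaleM p L)
                   (trans (cong (runtime k) (stepM-scaleM p L)) (runtime-scaleM k p (stepM L))))
        (sym (*-distribˡ-+ p _ _))

runtime-↭ : ∀ k {L₁ L₂} → L₁ ↭ L₂ → runtime k L₁ ≡ runtime k L₂
runtime-↭ zero q = refl
runtime-↭ (suc k) q = cong₂ _+_ (sumMap-↭ nonvalProb q) (runtime-↭ k (steps-↭ 1 q))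

runtime-mono : ∀ d k {L} → NonNeg L → runtime k L ≤ runtime (d +ℕ k) L
runtime-mono zero k h = ≤-refl
runtime-mono (suc d) k {L} h =
  ≤-trans (runtime-mono d k h)
          (≤-respʳ-≡ (p≤p+q (nonvalMass-nonNeg (NonNeg-steps (d +ℕ k) h))) (sym (runtime-suc (d +ℕ k) L)))
  where
  p≤p+q : ∀ {p q} → 0ℚ ≤ q → p ≤ p + q
  p≤p+q {p} 0≤q = ≤-respˡ-≡ (sym (+-identityʳ p)) (+-monoʳ-≤ p 0≤q)

Ek≡runtime : ∀ k M → Ek k M ≡ runtime k ((1ℚ , M) ∷ [])
Ek≡runtime zero M = refl
Ek≡runtime (suc k) M = trans (cong₂ _+_ (Ek≡runtime k M) 1-Pk) (sym (runtime-suc k _))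
  where
  L = steps k ((1ℚ , M) ∷ [])
  1-Pk : 1ℚ - Pk k M ≡ nonvalMass L
  1-Pk = begin
    1ℚ - Pk k M                               ≡⟨ cong (λ L' → 1ℚ - valMass L') (mdist-steps k M) ⟩
    1ℚ - valMass L                            ≡⟨ cong (_- valMass L) (sym (mass-steps k _)) ⟩
    mass L - valMass L                        ≡⟨ cong (_- valMass L) (sym (nonvalMass+valMass L)) ⟩
    (nonvalMass L + valMass L) - valMass L    ≡⟨ +-cancelʳ (nonvalMass L) (valMass L) ⟩
    nonvalMass L                              ∎
    where open ≡-Reasoning

-- Realizability

VDist : Set
VDist = List (ℚ × Val 0)

data Sel : MDist → VDist → Set where
  []   : Sel [] []
  skip : ∀ {e L vs} → Sel L vs → Sel (e ∷ L) vs
  take : ∀ {p V L vs} → Sel L vs → Sel ((p , val V) ∷ L) ((p , V) ∷ vs)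

Sel-none : ∀ L → Sel L []
Sel-none [] = []
Sel-none (e ∷ L) = skip (Sel-none L)

Sel-++ : ∀ {L1 L2 v1 v2} → Sel L1 v1 → Sel L2 v2 → Sel (L1 ++ L2) (v1 ++ v2)
Sel-++ [] s2 = s2
Sel-++ (skip s1) s2 = skip (Sel-++ s1 s2)
Sel-++ (take s1) s2 = take (Sel-++ s1 s2)

Sel-skipL : ∀ L1 {L2 vs} → Sel L2 vs → Sel (L1 ++ L2) vs
Sel-skipL [] s = s
Sel-skipL (e ∷ L1) s = skip (Sel-skipL L1 s)

Sel-split : ∀ L1 {L2 vs} → Sel (L1 ++ L2) vs → Σ VDist λ v1 → Σ VDist λ v2 → (vs ≡ v1 ++ v2) × Sel L1 v1 × Sel L2 v2
Sel-split [] s = [] , _ , refl , [] , s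
Sel-split (e ∷ L1) (skip s) with Sel-split L1 s
... | v1 , v2 , refl , s1 , s2 = v1 , v2 , refl , skip s1 , s2
Sel-split ((p , val V) ∷ L1) (take s) with Sel-split L1 s
... | v1 , v2 , refl , s1 , s2 = (p , V) ∷ v1 , v2 , refl , take s1 , s2

Sel-scale : ∀ p {L vs} → Sel L vs → Sel (scaleM p L) (scale p vs)
Sel-scale p [] = []
Sel-scale p (skip s) = skip (Sel-scale p s)
Sel-scale p (take s) = take (Sel-scale p s)

Sel-step : ∀ {L vs} → Sel L vs → Sel (stepM L) vs
Sel-step [] = []
Sel-step {(p , M) ∷ L} (skip s) = Sel-skipL (scaleM p (lift1 M)) (Sel-step s)
Sel-step {(p , val V) ∷ L} {(p , V) ∷ vs} (take s) =
  subst (λ z → Sel ((z , val V) ∷ stepM L) ((p , V) ∷ vs)) (sym (*-identityʳ p)) (take (Sel-step s))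

Sel-steps : ∀ d k {L vs} → Sel (steps k L) vs → Sel (steps (d +ℕ k) L) vs
Sel-steps zero k s = s
Sel-steps (suc d) k s = Sel-step (Sel-steps d k s)

Sel-↭ : ∀ {L L' vs} → L ↭ L' → Sel L vs → Σ VDist λ vs' → (vs ↭ vs') × Sel L' vs'
Sel-↭ ↭-refl s = _ , ↭-refl , s
Sel-↭ (↭-prep x q) (skip s) with Sel-↭ q s
... | vs' , r , s' = vs' , r , skip s'
Sel-↭ (↭-prep x q) (take s) with Sel-↭ q s
... | vs' , r , s' = _ , ↭-prep _ r , take s'
Sel-↭ (↭-swap x y q) (skip (skip s)) with Sel-↭ q s
... | vs' , r , s' = vs' , r , skip (skip s')
Sel-↭ (↭-swap x y q) (skip (take s)) with Sel-↭ q s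
... | vs' , r , s' = _ , ↭-prep _ r , take (skip s')
Sel-↭ (↭-swap x y q) (take (skip s)) with Sel-↭ q s
... | vs' , r , s' = _ , ↭-prep _ r , skip (take s')
Sel-↭ (↭-swap x y q) (take (take s)) with Sel-↭ q s
... | vs' , r , s' = _ , ↭-swap _ _ r , take (take s')
Sel-↭ (↭-trans q q') s with Sel-↭ q s
... | v1 , r1 , s1 with Sel-↭ q' s1
... | v2 , r2 , s2 = v2 , ↭-trans r1 r2 , s2

Sel-nonNeg : ∀ {L vs} → NonNeg L → Sel L vs → NonNeg vs
Sel-nonNeg [] [] = []
Sel-nonNeg (x ∷ a) (skip s) = Sel-nonNeg a s
Sel-nonNeg (x ∷ a) (take s) = x ∷ Sel-nonNeg a s

Sel-valMass : ∀ {L vs} → NonNeg L → Sel L vs → mass vs ≤ valMass L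
Sel-valMass [] [] = ≤-refl
Sel-valMass {(p , M) ∷ L} (x ∷ a) (skip s) = ≤-respˡ-≡ (sym (+-identityˡ _))
    (+-mono-≤ (valProb-nonNeg p M x) (Sel-valMass a s))
Sel-valMass {(p , val V) ∷ L} (x ∷ a) (take s) = +-monoʳ-≤ p (Sel-valMass a s)

-- The weight of a type is the runtime it still predicts: in RealL the runtime spent by L plus
-- the weight of the values it reaches must cover w.  The - 1ℚ in RealA is there because the
-- rule (λ) already charges the β-step that the application will perform.
mutual
  RealA : ℚ → Val 0 → Arrow → Set
  RealA w V (𝓜 ⇒ b) = Σ (Tm 1) λ M → (V ≡ lam M) × (∀ W u → RealI u W 𝓜 → RealL (w - 1ℚ + u) ((1ℚ , M [ W ]) ∷ []) b)

  RealI : ℚ → Val 0 → Inter → Set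
  RealI u V [] = u ≤ 0ℚ
  RealI u V ((q , A) ∷ 𝓜) = Σ ℚ λ w → Σ ℚ λ u' → RealA w V A × RealI u' V 𝓜 × (u ≤ q * w + u')

  RealL : ℚ → MDist → Dist → Set
  RealL w L b = Σ ℕ λ k → Σ VDist λ vs → Σ VDist λ vs' → Σ ℚ λ u →
             Sel (steps k L) vs × (vs ↭ vs') × RealVs vs' b u × (w ≤ runtime k L + u)

  RealVs : VDist → Dist → ℚ → Set
  RealVs vs [] u = (vs ≡ []) × (u ≤ 0ℚ)
  RealVs vs ((p , 𝓜) ∷ b) u = Σ (Val 0) λ V → Σ VDist λ vs' → Σ ℚ λ u1 → Σ ℚ λ u2 →
             (vs ≡ (p , V) ∷ vs') × RealI u1 V 𝓜 × RealVs vs' b u2 × (u ≤ p * u1 + u2)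

RealT : ℚ → Tm 0 → Dist → Set
RealT w M b = RealL w ((1ℚ , M) ∷ []) b

RealVs-down : ∀ {vs b u u'} → u' ≤ u → RealVs vs b u → RealVs vs b u'
RealVs-down {b = []} h (e , k) = e , ≤-trans h k
RealVs-down {b = (p , 𝓜) ∷ b} h (V , vs' , u1 , u2 , e , r , s , k) = V , vs' , u1 , u2 , e , r , s , ≤-trans h k

RealVs-↭-type : ∀ {vs b b2 u} → RealVs vs b u → b ↭ b2 → Σ VDist λ vs2 → (vs ↭ vs2) × RealVs vs2 b2 u
RealVs-↭-type s ↭-refl = _ , ↭-refl , s
RealVs-↭-type {b = (p , 𝓜) ∷ b} (V , vs' , u1 , u2 , refl , r , s , k) (↭-prep _ q) with RealVs-↭-type s q
... | vs2 , e , s2 = _ , ↭-prep _ e , (V , vs2 , u1 , u2 , refl , r , s2 , k)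
RealVs-↭-type {b = (p , 𝓜) ∷ (p' , 𝓜') ∷ b} {u = u} (V , _ , u1 , u2 , refl , r , (V' , vs' , u1' , u2' , refl , r' , s , k') , k) (↭-swap _ _ q) with RealVs-↭-type s q
... | vs2 , e , s2 = _ , ↭-swap _ _ e ,
      (V' , _ , u1' , p * u1 + u2' , refl , r' , (V , vs2 , u1 , u2' , refl , r , s2 , ≤-refl) ,
       ≤-respʳ-≡ (≤-trans k (+-monoʳ-≤ (p * u1) k')) (+-exchange (p * u1) (p' * u1') u2'))
RealVs-↭-type s (↭-trans q q') with RealVs-↭-type s q
... | v1 , e1 , s1 with RealVs-↭-type s1 q'
... | v2 , e2 , s2 = v2 , ↭-trans e1 e2 , s2

RealVs-↭-vals : ∀ {vs vs2 b u} → RealVs vs b u → vs ↭ vs2 → Σ Dist λ b2 → (b ↭ b2) × RealVs vs2 b2 u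
RealVs-↭-vals s ↭-refl = _ , ↭-refl , s
RealVs-↭-vals {b = []} (() , k) (↭-prep _ q)
RealVs-↭-vals {b = (p , 𝓜) ∷ b} (V , vs' , u1 , u2 , refl , r , s , k) (↭-prep _ q) with RealVs-↭-vals s q
... | b2 , e , s2 = _ , ↭-prep _ e , (V , _ , u1 , u2 , refl , r , s2 , k)
RealVs-↭-vals {b = []} (() , k) (↭-swap _ _ q)
RealVs-↭-vals {b = (p , 𝓜) ∷ []} (V , _ , u1 , u2 , refl , r , (() , _) , k) (↭-swap _ _ q)
RealVs-↭-vals {b = (p , 𝓜) ∷ (p' , 𝓜') ∷ b} {u = u} (V , _ , u1 , u2 , refl , r , (V' , vs' , u1' , u2' , refl , r' , s , k') , k) (↭-swap _ _ q) with RealVs-↭-vals s q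
... | b2 , e , s2 = _ , ↭-swap _ _ e ,
      (V' , _ , u1' , p * u1 + u2' , refl , r' , (V , _ , u1 , u2' , refl , r , s2 , ≤-refl) ,
       ≤-respʳ-≡ (≤-trans k (+-monoʳ-≤ (p * u1) k')) (+-exchange (p * u1) (p' * u1') u2'))
RealVs-↭-vals s (↭-trans q q') with RealVs-↭-vals s q
... | v1 , e1 , s1 with RealVs-↭-vals s1 q'
... | v2 , e2 , s2 = v2 , ↭-trans e1 e2 , s2

RealVs-++ : ∀ {v1 v2 b1 b2 u1 u2} → RealVs v1 b1 u1 → RealVs v2 b2 u2 → RealVs (v1 ++ v2) (b1 ++ b2) (u1 + u2)
RealVs-++ {b1 = []} {u1 = u1} {u2} (refl , k) s2 = RealVs-down (≤-respʳ-≡ (+-monoˡ-≤ u2 k) (+-identityˡ u2)) s2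
RealVs-++ {b1 = (p , 𝓜) ∷ b1} {u1 = u1} {u2} (V , vs' , w1 , w2 , refl , r , s , k) s2 =
  V , _ , w1 , w2 + u2 , refl , r , RealVs-++ s s2 , ≤-respʳ-≡ (+-monoˡ-≤ u2 k) (+-assoc (p * w1) w2 u2)

RealVs-split : ∀ v1 {v2 b u} → RealVs (v1 ++ v2) b u →
  Σ Dist λ b1 → Σ Dist λ b2 → Σ ℚ λ u1 → Σ ℚ λ u2 → (b ≡ b1 ++ b2) × RealVs v1 b1 u1 × RealVs v2 b2 u2 × (u ≤ u1 + u2)
RealVs-split [] {b = b} {u} s = [] , b , 0ℚ , u , refl , (refl , ≤-refl) , s , ≤-reflexive (sym (+-identityˡ u))
RealVs-split (x ∷ v1) {b = []} (() , _)
RealVs-split (x ∷ v1) {b = (p , 𝓜) ∷ b} {u} (V , vs' , w1 , w2 , refl , r , s , k) with RealVs-split v1 s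
... | b1 , b2 , u1 , u2 , refl , s1 , s2 , k2 =
  (p , 𝓜) ∷ b1 , b2 , p * w1 + u1 , u2 , refl , (V , v1 , w1 , u1 , refl , r , s1 , ≤-refl) , s2 ,
  ≤-trans k (≤-respʳ-≡ (+-monoʳ-≤ (p * w1) k2) (sym (+-assoc (p * w1) u1 u2)))

RealVs-scale : ∀ {p vs b u} → 0ℚ ≤ p → RealVs vs b u → RealVs (scale p vs) (scaleD p b) (p * u)
RealVs-scale {p} {b = []} h (refl , k) = refl , nonNeg*nonPos h k
RealVs-scale {p} {b = (q , 𝓜) ∷ b} {u} h (V , vs' , w1 , w2 , refl , r , s , k) =
  V , _ , w1 , p * w2 , refl , r , RealVs-scale h s ,
  ≤-respʳ-≡ (*-monoˡ-≤-nonNeg′ h k) (sym (*-+-assoc p q w1 w2))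

RealVs-norm : ∀ {vs b u} → RealVs vs b u → ‖ b ‖ ≡ mass vs
RealVs-norm {b = []} (refl , k) = refl
RealVs-norm {b = (p , 𝓜) ∷ b} (V , vs' , w1 , w2 , refl , r , s , k) = cong (p +_) (RealVs-norm s)

RealVs-tight : ∀ {vs b u} → Tight b → NonNeg vs → RealVs vs b u → u ≤ 0ℚ
RealVs-tight {b = []} t ps (refl , k) = k
RealVs-tight {b = (p , .[]) ∷ b} (refl ∷ t) (x ∷ ps) (V , vs' , w1 , w2 , refl , r , s , k) =
  ≤-trans k (+-mono-≤ (nonNeg*nonPos x r) (RealVs-tight t ps s))

RealL-down : ∀ {w w' L b} → w' ≤ w → RealL w L b → RealL w' L b
RealL-down h (k , vs , vs' , u , s , e , sv , h') = k , vs , vs' , u , s , e , sv , ≤-trans h h'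

RealL-↭-type : ∀ {w L b b2} → b ↭ b2 → RealL w L b → RealL w L b2
RealL-↭-type q (k , vs , vs' , u , s , e , sv , h) with RealVs-↭-type sv q
... | vs2 , e2 , sv2 = k , vs , vs2 , u , s , ↭-trans e e2 , sv2 , h

RealL-↭-mdist : ∀ {w L L2 b} → L ↭ L2 → RealL w L b → RealL w L2 b
RealL-↭-mdist {L = L} {L2} q (k , vs , vs' , u , s , e , sv , h) with Sel-↭ (steps-↭ k q) s
... | vs2 , e2 , s2 = k , vs2 , vs' , u , s2 , ↭-trans (↭-sym e2) e , sv , ≤-respʳ-≡ h (cong (_+ u) (runtime-↭ k q))

-- Values stay values and the runtime only grows, so a realization can be read off later.
postpone : ∀ {w L vs u} k → NonNeg L → ∀ d → Sel (steps k L) vs → w ≤ runtime k L + u →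
           Sel (steps (d +ℕ k) L) vs × w ≤ runtime (d +ℕ k) L + u
postpone k hL d s h = Sel-steps d k s , ≤-trans h (+-monoˡ-≤ _ (runtime-mono d k hL))

RealL-join : ∀ {w1 w2 L1 L2 b1 b2} → NonNeg L1 → NonNeg L2 → RealL w1 L1 b1 → RealL w2 L2 b2 →
  RealL (w1 + w2) (L1 ++ L2) (b1 ++ b2)
RealL-join {w1} {w2} {L1} {L2} p1 p2 (k1 , vs1 , vs1' , u1 , s1 , e1 , sv1 , h1) (k2 , vs2 , vs2' , u2 , s2 , e2 , sv2 , h2)
  with postpone k1 p1 k2 s1 h1 | postpone k2 p2 k1 s2 h2
... | s1' , h1' | s2' , h2' rewrite ℕ.+-comm k1 k2 =
  k2 +ℕ k1 , vs1 ++ vs2 , vs1' ++ vs2' , u1 + u2 ,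
  subst (λ z → Sel z (vs1 ++ vs2)) (sym (steps-++ (k2 +ℕ k1) L1 L2)) (Sel-++ s1' s2') ,
  ++⁺ e1 e2 , RealVs-++ sv1 sv2 ,
  ≤-trans (+-mono-≤ h1' h2')
      (≤-reflexive
          (trans (+-interchange (runtime (k2 +ℕ k1) L1) u1 (runtime (k2 +ℕ k1) L2) u2)
              (cong (_+ (u1 + u2)) (sym (runtime-++ (k2 +ℕ k1) L1 L2)))))

RealL-split : ∀ L1 {L2 w b} → RealL w (L1 ++ L2) b →
  Σ Dist λ b1 → Σ Dist λ b2 → Σ ℚ λ w1 → Σ ℚ λ w2 → (b ↭ b1 ++ b2) × RealL w1 L1 b1 × RealL w2 L2 b2 × (w ≤ w1 + w2)
RealL-split L1 {L2} {w} (k , vs , vs' , u , s , e , sv , h)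
  with Sel-split (steps k L1) (subst (λ z → Sel z vs) (steps-++ k L1 L2) s)
... | v1 , v2 , refl , s1 , s2 with RealVs-↭-vals sv (↭-sym e)
... | b' , eb , sv' with RealVs-split v1 sv'
... | b1 , b2 , u1 , u2 , refl , sv1 , sv2 , hu =
  b1 , b2 , runtime k L1 + u1 , runtime k L2 + u2 , eb ,
  (k , v1 , v1 , u1 , s1 , ↭-refl , sv1 , ≤-refl) ,
  (k , v2 , v2 , u2 , s2 , ↭-refl , sv2 , ≤-refl) ,
  ≤-trans h (≤-trans (+-monoʳ-≤ (runtime k (L1 ++ L2)) hu)
      (≤-reflexive
          (trans (cong (_+ (u1 + u2)) (runtime-++ k L1 L2)) (+-interchange (runtime k L1) (runtime k L2) u1 u2))))

RealL-scale : ∀ {p w L b} → 0ℚ ≤ p → RealL w L b → RealL (p * w) (scaleM p L) (scaleD p b)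
RealL-scale {p} {w} {L} hp (k , vs , vs' , u , s , e , sv , h) =
  k , scale p vs , scale p vs' , p * u ,
  subst (λ z → Sel z (scale p vs)) (sym (steps-scaleM k p L)) (Sel-scale p s) ,
  map⁺ _ e , RealVs-scale hp sv ,
  ≤-respʳ-≡ (*-monoˡ-≤-nonNeg′ hp h)
      (trans (*-distribˡ-+ p (runtime k L) u) (cong (_+ p * u) (sym (runtime-scaleM k p L))))

RealL-shift : ∀ {w L b} → RealL w (stepM L) b → RealL (w + nonvalMass L) L b
RealL-shift {w} {L} (k , vs , vs' , u , s , e , sv , h) =
  suc k , vs , vs' , u , subst (λ z → Sel z vs) (sym (steps-suc k L)) s , e , sv ,
  ≤-respʳ-≡ (+-monoˡ-≤ (nonvalMass L) h) (shuffle (runtime k (stepM L)) u (nonvalMass L))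
  where shuffle : ∀ a b c → (a + b) + c ≡ (c + a) + b
        shuffle = solve-∀ ringℚ

RealL-nil : ∀ {w L} → w ≤ 0ℚ → RealL w L []
RealL-nil {w} {L} h = 0 , [] , [] , 0ℚ , Sel-none L , ↭-refl , (refl , ≤-refl) , ≤-trans h
    (≤-reflexive (sym (+-identityˡ 0ℚ)))

NonValue : Tm 0 → Set
NonValue (val V) = ⊥
NonValue (app V W) = ⊤
NonValue (M ⊕ N) = ⊤
NonValue (lett N M) = ⊤

valProb-nonValue : ∀ p X → NonValue X → valProb (p , X) ≡ 0ℚ
valProb-nonValue p (app V W) _ = refl
valProb-nonValue p (M ⊕ N) _ = refl
valProb-nonValue p (lett N M) _ = refl

NonValues : MDist → Set
NonValues L = All (λ e → NonValue (proj₂ e)) L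

Sel-NonValues : ∀ {L vs} → NonValues L → Sel L vs → vs ≡ []
Sel-NonValues [] [] = refl
Sel-NonValues (x ∷ a) (skip s) = Sel-NonValues a s
Sel-NonValues (() ∷ a) (take s)

RealL-unshift : ∀ {w L b} → NonNeg L → NonValues L → RealL w L b → RealL (w - nonvalMass L) (stepM L) b
RealL-unshift {w} {L} {[]} hL nv (zero , vs , vs' , u , s , e , sv , h) with Sel-NonValues nv s
... | refl with ↭-empty-inv (↭-sym e)
... | refl = RealL-nil (w-n≤0 (≤-trans h (≤-respʳ-≡ (+-monoʳ-≤ 0ℚ (proj₂ sv)) (+-identityʳ 0ℚ))))
  where
  w-n≤0 : w ≤ 0ℚ → w - nonvalMass L ≤ 0ℚ
  w-n≤0 w≤0 = +-mono-≤ w≤0 (neg-antimono-≤ (nonvalMass-nonNeg hL))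
RealL-unshift {L = L} {_ ∷ _} hL nv (zero , vs , vs' , u , s , e , sv , h) with Sel-NonValues nv s
... | refl with ↭-empty-inv (↭-sym e)
RealL-unshift {b = _ ∷ _} hL nv (zero , _ , _ , _ , _ , _ , (_ , _ , _ , _ , () , _) , _) | refl | refl
RealL-unshift {w} {L} hL nv (suc k , vs , vs' , u , s , e , sv , h) =
  k , vs , vs' , u , subst (λ L' → Sel L' vs) (steps-suc k L) s , e , sv ,
  ≤-respʳ-≡ (+-monoˡ-≤ (- nonvalMass L) h) (cancel (nonvalMass L) (runtime k (stepM L)) u)
  where
  cancel : ∀ a b c → ((a + b) + c) - a ≡ b + c
  cancel = solve-∀ ringℚ

RealL-val : ∀ {u V 𝓜} p → RealI u V 𝓜 → RealL (p * u) ((p , val V) ∷ []) ((p , 𝓜) ∷ [])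
RealL-val {u} p r = 0 , _ , _ , p * u , take [] , ↭-refl ,
    (_ , [] , u , 0ℚ , refl , r , (refl , ≤-refl) , ≤-reflexive (sym (+-identityʳ (p * u)))) ,
  ≤-reflexive (sym (+-identityˡ (p * u)))

RealI-down : ∀ {u u' V 𝓜} → u' ≤ u → RealI u V 𝓜 → RealI u' V 𝓜
RealI-down {𝓜 = []} h r = ≤-trans h r
RealI-down {𝓜 = (q , A) ∷ 𝓜} h (w , u'' , ra , ri , k) = w , u'' , ra , ri , ≤-trans h k

RealI-↭ : ∀ {u V 𝓜 𝓜'} → RealI u V 𝓜 → 𝓜 ↭ 𝓜' → RealI u V 𝓜'
RealI-↭ r ↭-refl = r
RealI-↭ {𝓜 = (q , A) ∷ 𝓜} (w , u' , ra , ri , h) (↭-prep _ p) = w , u' , ra , RealI-↭ ri p , h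
RealI-↭ {u} {𝓜 = (q , A) ∷ (q' , A') ∷ 𝓜} (w , u' , ra , (w' , u'' , ra' , ri , h') , h) (↭-swap _ _ p) =
  w' , q * w + u'' , ra' , (w , u'' , ra , RealI-↭ ri p , ≤-refl) ,
  ≤-respʳ-≡ (≤-trans h (+-monoʳ-≤ (q * w) h')) (+-exchange (q * w) (q' * w') u'')
RealI-↭ r (↭-trans p p') = RealI-↭ (RealI-↭ r p) p'

mutual
  RealA-≈ : ∀ {A A' w V} → A ≈A A' → RealA w V A → RealA w V A'
  RealA-≈ (≈⇒ i d) (M , e , h) = M , e , λ W u r → RealL-≈ d (h W u (RealI-≈⁻ i r))

  RealA-≈⁻ : ∀ {A A' w V} → A ≈A A' → RealA w V A' → RealA w V A
  RealA-≈⁻ (≈⇒ i d) (M , e , h) = M , e , λ W u r → RealL-≈⁻ d (h W u (RealI-≈ i r))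

  RealI-≈ : ∀ {𝓜 𝓜' u V} → 𝓜 ≈I 𝓜' → RealI u V 𝓜 → RealI u V 𝓜'
  RealI-≈ (≈I-intro p pw) r = RealI-pw pw (RealI-↭ r p)

  RealI-≈⁻ : ∀ {𝓜 𝓜' u V} → 𝓜 ≈I 𝓜' → RealI u V 𝓜' → RealI u V 𝓜
  RealI-≈⁻ (≈I-intro p pw) r = RealI-↭ (RealI-pw⁻ pw r) (↭-sym p)

  RealI-pw : ∀ {𝓜 𝓜' u V} → PwI 𝓜 𝓜' → RealI u V 𝓜 → RealI u V 𝓜'
  RealI-pw [] r = r
  RealI-pw (eq ∷ pw) (w , u' , ra , ri , h) = w , u' , RealA-≈ eq ra , RealI-pw pw ri , h

  RealI-pw⁻ : ∀ {𝓜 𝓜' u V} → PwI 𝓜 𝓜' → RealI u V 𝓜' → RealI u V 𝓜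
  RealI-pw⁻ [] r = r
  RealI-pw⁻ (eq ∷ pw) (w , u' , ra , ri , h) = w , u' , RealA-≈⁻ eq ra , RealI-pw⁻ pw ri , h

  RealVs-pw : ∀ {a a' vs u} → PwD a a' → RealVs vs a u → RealVs vs a' u
  RealVs-pw [] s = s
  RealVs-pw (eq ∷ pw) (V , vs' , u1 , u2 , e , r , s , h) = V , vs' , u1 , u2 , e , RealI-≈ eq r , RealVs-pw pw s , h

  RealVs-pw⁻ : ∀ {a a' vs u} → PwD a a' → RealVs vs a' u → RealVs vs a u
  RealVs-pw⁻ [] s = s
  RealVs-pw⁻ (eq ∷ pw) (V , vs' , u1 , u2 , e , r , s , h) = V , vs' , u1 , u2 , e , RealI-≈⁻ eq r , RealVs-pw⁻ pw s , h

  RealL-≈ : ∀ {a a' w L} → a ≈D a' → RealL w L a → RealL w L a'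
  RealL-≈ (≈D-intro p pw) r with RealL-↭-type p r
  ... | (k , vs , vs' , u , s , e , sv , h) = k , vs , vs' , u , s , e , RealVs-pw pw sv , h

  RealL-≈⁻ : ∀ {a a' w L} → a ≈D a' → RealL w L a' → RealL w L a
  RealL-≈⁻ (≈D-intro p pw) (k , vs , vs' , u , s , e , sv , h) = RealL-↭-type (↭-sym p)
      (k , vs , vs' , u , s , e , RealVs-pw⁻ pw sv , h)

RealI-++ : ∀ {u V} 𝓜1 {𝓜2} → RealI u V (𝓜1 ++ 𝓜2) → Σ ℚ λ u1 → Σ ℚ λ u2 → RealI u1 V 𝓜1 × RealI u2 V 𝓜2 × (u ≤ u1 + u2)
RealI-++ {u} [] r = 0ℚ , u , ≤-refl , r , ≤-reflexive (sym (+-identityˡ u))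
RealI-++ {u} ((q , A) ∷ 𝓜1) (w , u' , ra , ri , h) with RealI-++ 𝓜1 ri
... | u1 , u2 , r1 , r2 , h' = q * w + u1 , u2 , (w , u1 , ra , r1 , ≤-refl) , r2 ,
  ≤-trans h (≤-respʳ-≡ (+-monoʳ-≤ (q * w) h') (sym (+-assoc (q * w) u1 u2)))

RealI-scale : ∀ {u V} q 𝓜 → RealI u V (scaleI q 𝓜) → Σ ℚ λ u' → RealI u' V 𝓜 × (u ≤ q * u')
RealI-scale {u} q [] r = 0ℚ , ≤-refl , ≤-trans r (≤-reflexive (sym (*-zeroʳ q)))
RealI-scale {u} q ((q' , A) ∷ 𝓜) (w , u' , ra , ri , h) with RealI-scale q 𝓜 ri
... | u'' , r' , h' = q' * w + u'' , (w , u'' , ra , r' , ≤-refl) ,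
  ≤-trans h (≤-respʳ-≡ (+-monoʳ-≤ ((q * q') * w) h') (*-+-assoc q q' w u''))


module _ (M : Tm 1) where

  letL : MDist → MDist
  letL = map (letE M)

  bodies : VDist → MDist
  bodies = map (λ { (p , V) → (p , M [ V ]) })

  nonvalMass-letL : ∀ L → nonvalMass (letL L) ≡ mass L
  nonvalMass-letL [] = refl
  nonvalMass-letL ((p , X) ∷ L) = cong (p +_) (nonvalMass-letL L)

  letL-scaleM : ∀ p L → letL (scaleM p L) ≡ scaleM p (letL L)
  letL-scaleM p [] = refl
  letL-scaleM p ((q , X) ∷ L) = cong (_ ∷_) (letL-scaleM p L)

  -- A value entry of N fires let-β, which costs its probability; any other entry
  -- reduces inside the let exactly as it reduces on its own.
  RealL-let-entry : ∀ {W b} p X → 0ℚ ≤ p → RealL W (letL (scaleM p (lift1 X))) b →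
                    RealL (W - valProb (p , X)) (scaleM p (lift1 (lett X M))) b
  RealL-let-entry {W} {b} p (val V) hp r =
    subst (λ q → RealL (W - p) ((q , M [ V ]) ∷ []) b) (*-identityʳ (p * 1ℚ))
      (RealL-down (≤-reflexive (cong (λ x → W - x) (sym (trans (+-identityʳ (p * 1ℚ)) (*-identityʳ p)))))
        (RealL-unshift (nonNeg*nonNeg hp 0≤1 ∷ []) (tt ∷ []) r))
  RealL-let-entry p (app (var ()) W')
  RealL-let-entry {W} p (app (lam P) W') hp r = RealL-down (≤-reflexive (+-identityʳ W)) r
  RealL-let-entry {W} p (N₁ ⊕ N₂) hp r = RealL-down (≤-reflexive (+-identityʳ W)) r
  RealL-let-entry {W} {b} p (lett N P) hp r =
    RealL-down (≤-reflexive (+-identityʳ W)) (subst (λ L → RealL W L b) (letL-scaleM p (lift1 (lett N P))) r)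

  RealL-let-stepM : ∀ L {W b} → NonNeg L → RealL W (letL (stepM L)) b → RealL (W - valMass L) (stepM (letL L)) b
  RealL-let-stepM [] {W} hL r = RealL-down (≤-reflexive (+-identityʳ W)) r
  RealL-let-stepM ((p , X) ∷ L) {W} {b} (hp ∷ hL) r
    with RealL-split (letL (scaleM p (lift1 X)))
           (subst (λ L' → RealL W L' b) (List.map-++ (letE M) (scaleM p (lift1 X)) (stepM L)) r)
  ... | b₁ , b₂ , W₁ , W₂ , eb , r₁ , r₂ , hW =
    RealL-↭-type (↭-sym eb)
      (RealL-down W-split
        (RealL-join (NonNeg-scale hp (NonNeg-lift1 (lett X M))) (NonNeg-stepM (NonNeg-letE M hL))
                    (RealL-let-entry p X hp r₁) (RealL-let-stepM L hL r₂)))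
    where
    W-split : W - (valProb (p , X) + valMass L) ≤ (W₁ - valProb (p , X)) + (W₂ - valMass L)
    W-split = ≤-respʳ-≡ (+-monoˡ-≤ _ hW)
      (trans (cong (W₁ + W₂ +_) (neg-distrib-+ (valProb (p , X)) (valMass L)))
             (+-interchange W₁ W₂ (- valProb (p , X)) (- valMass L)))

  RealL-let-values : ∀ {L vs C b} → NonNeg L → Sel L vs → RealL C (bodies vs) b →
                     RealL (mass L + C) (letL L) b
  RealL-let-values {C = C} [] [] r = RealL-down (≤-reflexive (+-identityˡ C)) r
  RealL-let-values {(p , X) ∷ L} {C = C} (hp ∷ hL) (skip s) r =
    RealL-down (≤-reflexive (cost p (mass L) C))
      (RealL-join {L1 = (p , lett X M) ∷ []} {b1 = []} (hp ∷ []) (NonNeg-letE M hL)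
                  (RealL-shift {b = []} (RealL-nil ≤-refl)) (RealL-let-values hL s r))
    where
    cost : ∀ p m C → (p + m) + C ≡ (0ℚ + (p + 0ℚ)) + (m + C)
    cost = solve-∀ ringℚ
  RealL-let-values {(p , val V) ∷ L} {C = C} {b} (hp ∷ hL) (take s) r
    with RealL-split ((p , M [ V ]) ∷ []) r
  ... | b₁ , b₂ , c₁ , c₂ , eb , r₁ , r₂ , hC =
    RealL-↭-type (↭-sym eb)
      (RealL-down (≤-trans (+-monoʳ-≤ (p + mass L) hC) (≤-reflexive (cost p (mass L) c₁ c₂)))
        (RealL-join {L1 = (p , lett (val V) M) ∷ []} (hp ∷ []) (NonNeg-letE M hL)
          (RealL-shift (subst (λ q → RealL c₁ ((q , M [ V ]) ∷ []) b₁) (sym (*-identityʳ p)) r₁))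
          (RealL-let-values hL s r₂)))
    where
    cost : ∀ p m c₁ c₂ → (p + m) + (c₁ + c₂) ≡ (c₁ + (p + 0ℚ)) + (m + c₂)
    cost = solve-∀ ringℚ

  -- The summand mass L pays for firing let-β on every value N reaches.
  RealL-let : ∀ k {L vs C b} → NonNeg L → Sel (steps k L) vs → RealL C (bodies vs) b →
              RealL (runtime k L + mass L + C) (letL L) b
  RealL-let zero {L} {C = C} hL s r =
    RealL-down (≤-reflexive (trans (+-assoc 0ℚ (mass L) C) (+-identityˡ _))) (RealL-let-values hL s r)
  RealL-let (suc k) {L} {vs} {C} {b} hL s r =
    RealL-down (≤-reflexive weights) (RealL-shift (RealL-let-stepM L hL ih))
    where
    ih : RealL (runtime k (stepM L) + mass (stepM L) + C) (letL (stepM L)) b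
    ih = RealL-let k (NonNeg-stepM hL) (subst (λ L' → Sel L' vs) (steps-suc k L) s) r
    E = runtime k (stepM L)
    n = nonvalMass L
    v = valMass L
    shuffle : ∀ E n v C → (n + E) + (n + v) + C ≡ (E + (n + v) + C - v) + (n + v)
    shuffle = solve-∀ ringℚ
    weights : runtime (suc k) L + mass L + C ≡ (E + mass (stepM L) + C - v) + nonvalMass (letL L)
    weights = begin
      (n + E) + mass L + C                ≡⟨ cong (λ m → (n + E) + m + C) (sym (nonvalMass+valMass L)) ⟩
      (n + E) + (n + v) + C               ≡⟨ shuffle E n v C ⟩
      (E + (n + v) + C - v) + (n + v)     ≡⟨ cong₂ (λ m m' → (E + m + C - v) + m')
                                                   (trans (nonvalMass+valMass L) (sym (mass-stepM L)))
                                                   (trans (nonvalMass+valMass L) (sym (nonvalMass-letL L))) ⟩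
      (E + mass (stepM L) + C - v) + nonvalMass (letL L) ∎
      where open ≡-Reasoning

-- Soundness

RealC : ∀ {n} → Ctx n → (Fin n → Val 0) → ℚ → Set
RealC [] σ u = u ≤ 0ℚ
RealC (𝓜 ∷ Γ) σ u = Σ ℚ λ u₁ → Σ ℚ λ u₂ → RealI u₁ (σ zero) 𝓜 × RealC Γ (σ ∘ suc) u₂ × (u ≤ u₁ + u₂)

RealC-down : ∀ {m} {Γ : Ctx m} {σ u u'} → u' ≤ u → RealC Γ σ u → RealC Γ σ u'
RealC-down {Γ = []} h r = ≤-trans h r
RealC-down {Γ = 𝓜 ∷ Γ} h (u₁ , u₂ , r₁ , r₂ , h') = u₁ , u₂ , r₁ , r₂ , ≤-trans h h'

RealC-∅ : ∀ {n σ u} → RealC (∅ {n}) σ u → u ≤ 0ℚ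
RealC-∅ {zero} r = r
RealC-∅ {suc n} (u₁ , u₂ , r₁ , r₂ , h) = ≤-trans h (+-mono-≤ r₁ (RealC-∅ {n} r₂))

RealC-var : ∀ {n} (x : Fin n) {𝓜 σ u} → RealC (∅ [ x ]≔ 𝓜) σ u → RealI u (σ x) 𝓜
RealC-var {suc n} zero (u₁ , u₂ , r₁ , r₂ , h) =
  RealI-down (≤-trans h (≤-respʳ-≡ (+-monoʳ-≤ u₁ (RealC-∅ {n} r₂)) (+-identityʳ u₁))) r₁
RealC-var {suc n} (suc x) (u₁ , u₂ , r₁ , r₂ , h) =
  RealC-var x (RealC-down (≤-trans h (≤-respʳ-≡ (+-monoˡ-≤ u₂ r₁) (+-identityˡ u₂))) r₂)

RealC-split : ∀ {n} (Γ Δ : Ctx n) {σ u} → RealC (Γ ⊎C Δ) σ u →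
              Σ ℚ λ U₁ → Σ ℚ λ U₂ → RealC Γ σ U₁ × RealC Δ σ U₂ × (u ≤ U₁ + U₂)
RealC-split [] [] {u = u} r = u , 0ℚ , r , ≤-refl , ≤-reflexive (sym (+-identityʳ u))
RealC-split (𝓜 ∷ Γ) (𝓝 ∷ Δ) (u₁ , u₂ , r₁ , r₂ , h) with RealI-++ 𝓜 r₁ | RealC-split Γ Δ r₂
... | a₁ , a₂ , s₁ , s₂ , h₁ | b₁ , b₂ , t₁ , t₂ , h₂ =
  a₁ + b₁ , a₂ + b₂ , (a₁ , b₁ , s₁ , t₁ , ≤-refl) , (a₂ , b₂ , s₂ , t₂ , ≤-refl) ,
  ≤-trans h (≤-respʳ-≡ (+-mono-≤ h₁ h₂) (+-interchange a₁ a₂ b₁ b₂))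

RealC-scale : ∀ {n} q (Γ : Ctx n) {σ u} → RealC (q ·C Γ) σ u → Σ ℚ λ U → RealC Γ σ U × (u ≤ q * U)
RealC-scale q [] r = 0ℚ , ≤-refl , ≤-trans r (≤-reflexive (sym (*-zeroʳ q)))
RealC-scale q (𝓜 ∷ Γ) (u₁ , u₂ , r₁ , r₂ , h) with RealI-scale q 𝓜 r₁ | RealC-scale q Γ r₂
... | a , s , h₁ | b , t , h₂ = a + b , (a , b , s , t , ≤-refl) ,
  ≤-trans h (≤-respʳ-≡ (+-mono-≤ h₁ h₂) (sym (*-distribˡ-+ q a b)))

RealC-≈ : ∀ {n} {Γ Γ' : Ctx n} {σ u} → Γ ≈C Γ' → RealC Γ' σ u → RealC Γ σ u
RealC-≈ [] r = r
RealC-≈ (e ∷ es) (u₁ , u₂ , r₁ , r₂ , h) = u₁ , u₂ , RealI-≈⁻ e r₁ , RealC-≈ es r₂ , h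

NonNeg-bodies : ∀ (M : Tm 1) {vs} → NonNeg vs → NonNeg (bodies M vs)
NonNeg-bodies M [] = []
NonNeg-bodies M (x ∷ h) = x ∷ NonNeg-bodies M h

mutual
  fundamentalA : ∀ {n} {Γ : Ctx n} {w V A σ U} → Γ ⊢A[ w ] V ∶ A → RealC Γ σ U → RealA (w + U) (subV σ V) A
  fundamentalA {σ = σ} {U} (⊢λ {w = w} {M} {b} d) rc = subT (extS σ) M , refl , λ W u r →
    RealL-down (≤-reflexive (weights w U u))
      (subst (λ N → RealL (w + (u + U)) ((1ℚ , N) ∷ []) b) (sym (subT-extS-[] σ W M))
        (fundamentalT {σ = W ∷ₛ σ} d (u , U , r , rc , ≤-refl)))
    where
    weights : ∀ w U u → w + 1ℚ + U - 1ℚ + u ≡ w + (u + U)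
    weights = solve-∀ ringℚ
  fundamentalA (convA d eC eA) rc = RealA-≈ eA (fundamentalA d (RealC-≈ eC rc))

  fundamentalI : ∀ {n} {Γ : Ctx n} {w V 𝓜 σ U} → Γ ⊢I[ w ] V ∶ 𝓜 → RealC Γ σ U → RealI (w + U) (subV σ V) 𝓜
  fundamentalI {U = U} (⊢var {x} wf) rc = RealI-down (≤-reflexive (+-identityˡ U)) (RealC-var x rc)
  fundamentalI (⊢! b) rc = fundamentalBang b rc
  fundamentalI (convI d eC eI) rc = RealI-≈ eI (fundamentalI d (RealC-≈ eC rc))

  fundamentalBang : ∀ {n} {Γ : Ctx n} {w V 𝓜 σ U} → Bang Γ w V 𝓜 → RealC Γ σ U → RealI (w + U) (subV σ V) 𝓜
  fundamentalBang {n} [] rc = ≤-respʳ-≡ (+-monoʳ-≤ 0ℚ (RealC-∅ {n} rc)) (+-identityʳ 0ℚ)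
  fundamentalBang (cons {Γ} {Γ'} {w} {w'} q hq dA rest) rc with RealC-split (q ·C Γ) Γ' rc
  ... | U₁ , U₂ , r₁ , r₂ , h with RealC-scale q Γ r₁
  ... | U₁' , r₁' , h₁ = w + U₁' , w' + U₂ , fundamentalA dA r₁' , fundamentalBang rest r₂ ,
    ≤-trans (+-monoʳ-≤ (q * w + w') (≤-trans h (+-monoˡ-≤ U₂ h₁))) (≤-reflexive (weights q w w' U₁' U₂))
    where
    weights : ∀ q w w' U₁ U₂ → (q * w + w') + (q * U₁ + U₂) ≡ q * (w + U₁) + (w' + U₂)
    weights = solve-∀ ringℚ

  fundamentalT : ∀ {n} {Γ : Ctx n} {w M b σ U} → Γ ⊢[ w ] M ∶ b → RealC Γ σ U → RealT (w + U) (subT σ M) b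
  fundamentalT {n} ⊢zero rc = RealL-nil (≤-respʳ-≡ (+-monoʳ-≤ 0ℚ (RealC-∅ {n} rc)) (+-identityʳ 0ℚ))
  fundamentalT {σ = σ} {U} (⊢app {Γ} {Δ} {w} {v} {V} {W} dV dW) rc with RealC-split Γ Δ rc
  ... | U₁ , U₂ , r₁ , r₂ , h with fundamentalI {σ = σ} dV r₁
  ... | w₁ , u' , (P , V≡λ , f) , ri , hw rewrite V≡λ =
    RealL-down weights (RealL-shift (f (subV σ W) (v + U₂) (fundamentalI dW r₂)))
    where
    weights : w + v + U ≤ (w₁ - 1ℚ + (v + U₂)) + 1ℚ
    weights = begin
      w + v + U                      ≤⟨ +-monoʳ-≤ (w + v) h ⟩
      w + v + (U₁ + U₂)              ≡⟨ +-interchange w v U₁ U₂ ⟩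
      (w + U₁) + (v + U₂)            ≤⟨ +-monoˡ-≤ (v + U₂) (≤-trans hw (≤-respʳ-≡ (+-monoʳ-≤ (1ℚ * w₁) ri) (one w₁))) ⟩
      w₁ + (v + U₂)                  ≡⟨ shuffle w₁ (v + U₂) ⟩
      (w₁ - 1ℚ + (v + U₂)) + 1ℚ      ∎
      where
      open ≤-Reasoning
      one : ∀ w → 1ℚ * w + 0ℚ ≡ w
      one = solve-∀ ringℚ
      shuffle : ∀ a c → a + c ≡ (a - 1ℚ + c) + 1ℚ
      shuffle = solve-∀ ringℚ
  fundamentalT {σ = σ} {U} (⊢⊕ {Γ} {Δ} {w} {v} {M} {N} dM dN) rc with RealC-split (½ ·C Γ) (½ ·C Δ) rc
  ... | U₁ , U₂ , r₁ , r₂ , h with RealC-scale ½ Γ r₁ | RealC-scale ½ Δ r₂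
  ... | U₁' , r₁' , h₁ | U₂' , r₂' , h₂ =
    RealL-down weights (RealL-shift {L = (1ℚ , subT σ M ⊕ subT σ N) ∷ []}
      (RealL-join (NonNeg-scale 0≤½ (0≤1 ∷ [])) (NonNeg-scale 0≤½ (0≤1 ∷ []))
        (RealL-scale 0≤½ (fundamentalT dM r₁')) (RealL-scale 0≤½ (fundamentalT dN r₂'))))
    where
    halves : ∀ h w v a b → h * w + h * v + 1ℚ + (h * a + h * b) ≡ (h * (w + a) + h * (v + b)) + 1ℚ
    halves = solve-∀ ringℚ
    weights : ½ * w + ½ * v + 1ℚ + U ≤ (½ * (w + U₁') + ½ * (v + U₂')) + 1ℚ
    weights = ≤-trans (+-monoʳ-≤ (½ * w + ½ * v + 1ℚ) (≤-trans h (+-mono-≤ h₁ h₂)))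
                      (≤-reflexive (halves ½ w v U₁' U₂'))
  fundamentalT {σ = σ} {U} (⊢let {Γ} {Δ} {v} {w} {N} {M} dN lb) rc with RealC-split Γ Δ rc
  ... | U₁ , U₂ , r₁ , r₂ , h with fundamentalT {σ = σ} dN r₁
  ... | k , vs , vs' , u , s , e , sv , hv =
    RealL-down weights (RealL-let (subT (extS σ) M) k (0≤1 ∷ []) s
      (RealL-↭-mdist (map⁺ _ (↭-sym e))
        (fundamentalLet lb r₂ sv (All-resp-↭ e (Sel-nonNeg (NonNeg-steps k (0≤1 ∷ [])) s)))))
    where
    E = runtime k ((1ℚ , subT σ N) ∷ [])
    weights : w + v + 1ℚ + U ≤ E + (1ℚ + 0ℚ) + (w + U₂ + u)
    weights = begin
      w + v + 1ℚ + U                 ≤⟨ +-monoʳ-≤ (w + v + 1ℚ) h ⟩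
      w + v + 1ℚ + (U₁ + U₂)         ≡⟨ shuffle₁ w v U₁ U₂ ⟩
      (v + U₁) + (w + 1ℚ + U₂)       ≤⟨ +-monoˡ-≤ (w + 1ℚ + U₂) hv ⟩
      (E + u) + (w + 1ℚ + U₂)        ≡⟨ shuffle₂ E u w U₂ ⟩
      E + (1ℚ + 0ℚ) + (w + U₂ + u)   ∎
      where
      open ≤-Reasoning
      shuffle₁ : ∀ w v a b → w + v + 1ℚ + (a + b) ≡ (v + a) + (w + 1ℚ + b)
      shuffle₁ = solve-∀ ringℚ
      shuffle₂ : ∀ E u w b → (E + u) + (w + 1ℚ + b) ≡ E + (1ℚ + 0ℚ) + (w + b + u)
      shuffle₂ = solve-∀ ringℚ
  fundamentalT {U = U} (⊢val {w = w} {𝓜 = 𝓜} d) rc =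
    RealL-down {b = (1ℚ , 𝓜) ∷ []} (≤-reflexive (sym (*-identityˡ (w + U)))) (RealL-val 1ℚ (fundamentalI d rc))
  fundamentalT (convT d eC eD) rc = RealL-≈ eD (fundamentalT d (RealC-≈ eC rc))

  fundamentalLet : ∀ {n} {M : Tm (suc n)} {a Δ w b σ U vs u} → LetBodies M a Δ w b → RealC Δ σ U →
                   RealVs vs a u → NonNeg vs → RealL (w + U + u) (bodies (subT (extS σ) M) vs) b
  fundamentalLet {n} [] rc (refl , hu) hvs =
    RealL-nil (+-mono-≤ (+-monoʳ-≤ 0ℚ (RealC-∅ {n} rc)) hu)
  fundamentalLet {M = M} {σ = σ} {U = U} {u = u} (cons {p} {𝓜} {a} {Δ} {Δ'} {w} {w'} {b} d rest) rc
                 (V , vs' , u₁ , u₂ , refl , r , sv , hu) (hp ∷ hvs) with RealC-split (p ·C Δ) Δ' rc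
  ... | U₁ , U₂ , r₁ , r₂ , h with RealC-scale p Δ r₁
  ... | U₁' , r₁' , h₁ =
    RealL-down weights (RealL-join {L1 = (p , subT (extS σ) M [ V ]) ∷ []} (hp ∷ []) (NonNeg-bodies _ hvs)
      (subst (λ q → RealL (p * (w + (u₁ + U₁'))) ((q , subT (extS σ) M [ V ]) ∷ []) (scaleD p b)) (*-identityʳ p)
        (RealL-scale hp (subst (λ N → RealL (w + (u₁ + U₁')) ((1ℚ , N) ∷ []) b) (sym (subT-extS-[] σ V M))
          (fundamentalT {σ = V ∷ₛ σ} d (u₁ , U₁' , r , r₁' , ≤-refl)))))
      (fundamentalLet rest r₂ sv hvs))
    where
    shuffle : ∀ p w w' a b c d → (p * w + w') + (p * a + b) + (p * c + d) ≡ p * (w + (c + a)) + (w' + b + d)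
    shuffle = solve-∀ ringℚ
    weights : (p * w + w') + U + u ≤ p * (w + (u₁ + U₁')) + (w' + U₂ + u₂)
    weights = ≤-trans (+-mono-≤ (+-monoʳ-≤ (p * w + w') (≤-trans h (+-monoˡ-≤ U₂ h₁))) hu)
                      (≤-reflexive (shuffle p w w' U₁' U₂ u₁ u₂))

soundness : (M : Tm 0) {w : ℚ} {a : Dist} → Tight a → [] ⊢[ w ] M ∶ a →
            Σ ℕ λ k → (‖ a ‖ ≤ Pk k M) × (w ≤ Ek k M)
soundness M {w} {a} t d with subst₂ (λ w' M' → RealT w' M' a) (+-identityʳ w) (subT-closed (λ ()) M)
    (fundamentalT {σ = λ ()} d ≤-refl)
... | k , vs , vs' , u , s , e , sv , h = k , norm≤Pk , w≤Ek
  where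
  L = steps k ((1ℚ , M) ∷ [])
  norm≤Pk : ‖ a ‖ ≤ Pk k M
  norm≤Pk = begin
    ‖ a ‖       ≡⟨ RealVs-norm sv ⟩
    mass vs'   ≡⟨ mass-↭ (↭-sym e) ⟩
    mass vs    ≤⟨ Sel-valMass (NonNeg-steps k (0≤1 ∷ [])) s ⟩
    valMass L   ≡⟨ cong valMass (sym (mdist-steps k M)) ⟩
    Pk k M      ∎
    where open ≤-Reasoning
  w≤Ek : w ≤ Ek k M
  w≤Ek = begin
    w                                ≤⟨ h ⟩
    runtime k ((1ℚ , M) ∷ []) + u    ≤⟨ +-monoʳ-≤ (runtime k ((1ℚ , M) ∷ []))
        (RealVs-tight t (All-resp-↭ e (Sel-nonNeg (NonNeg-steps k (0≤1 ∷ [])) s)) sv) ⟩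
    runtime k ((1ℚ , M) ∷ []) + 0ℚ   ≡⟨ +-identityʳ _ ⟩
    runtime k ((1ℚ , M) ∷ [])        ≡⟨ Ek≡runtime k M ⟨
    Ek k M                           ∎
    where open ≤-Reasoning

mutual
  ≈A-refl : ∀ A → A ≈A A
  ≈A-refl (𝓜 ⇒ b) = ≈⇒ (≈I-refl 𝓜) (≈D-refl b)

  ≈I-refl : ∀ 𝓜 → 𝓜 ≈I 𝓜
  ≈I-refl 𝓜 = ≈I-intro ↭-refl (PwI-refl 𝓜)

  PwI-refl : ∀ 𝓜 → PwI 𝓜 𝓜
  PwI-refl [] = []
  PwI-refl ((q , A) ∷ 𝓜) = ≈A-refl A ∷ PwI-refl 𝓜

  ≈D-refl : ∀ a → a ≈D a
  ≈D-refl a = ≈D-intro ↭-refl (PwD-refl a)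

  PwD-refl : ∀ a → PwD a a
  PwD-refl [] = []
  PwD-refl ((p , 𝓜) ∷ a) = ≈I-refl 𝓜 ∷ PwD-refl a

PwI-↭ : ∀ {X Y Z} → PwI X Y → Y ↭ Z → Σ Inter λ X' → (X ↭ X') × PwI X' Z
PwI-↭ pw ↭-refl = _ , ↭-refl , pw
PwI-↭ (e ∷ pw) (↭-prep _ p) with PwI-↭ pw p
... | X' , q , pw' = _ , ↭-prep _ q , e ∷ pw'
PwI-↭ (e1 ∷ e2 ∷ pw) (↭-swap _ _ p) with PwI-↭ pw p
... | X' , q , pw' = _ , ↭-swap _ _ q , e2 ∷ e1 ∷ pw'
PwI-↭ pw (↭-trans p p') with PwI-↭ pw p
... | X1 , q1 , pw1 with PwI-↭ pw1 p'
... | X2 , q2 , pw2 = X2 , ↭-trans q1 q2 , pw2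

PwD-↭ : ∀ {X Y Z} → PwD X Y → Y ↭ Z → Σ Dist λ X' → (X ↭ X') × PwD X' Z
PwD-↭ pw ↭-refl = _ , ↭-refl , pw
PwD-↭ (e ∷ pw) (↭-prep _ p) with PwD-↭ pw p
... | X' , q , pw' = _ , ↭-prep _ q , e ∷ pw'
PwD-↭ (e1 ∷ e2 ∷ pw) (↭-swap _ _ p) with PwD-↭ pw p
... | X' , q , pw' = _ , ↭-swap _ _ q , e2 ∷ e1 ∷ pw'
PwD-↭ pw (↭-trans p p') with PwD-↭ pw p
... | X1 , q1 , pw1 with PwD-↭ pw1 p'
... | X2 , q2 , pw2 = X2 , ↭-trans q1 q2 , pw2

mutual
  ≈A-sym : ∀ {A B} → A ≈A B → B ≈A A
  ≈A-sym (≈⇒ i d) = ≈⇒ (≈I-sym i) (≈D-sym d)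

  ≈I-sym : ∀ {A B} → A ≈I B → B ≈I A
  ≈I-sym (≈I-intro p pw) with PwI-↭ (PwI-sym pw) (↭-sym p)
  ... | X , q , pw' = ≈I-intro q pw'

  PwI-sym : ∀ {A B} → PwI A B → PwI B A
  PwI-sym [] = []
  PwI-sym (e ∷ pw) = ≈A-sym e ∷ PwI-sym pw

  ≈D-sym : ∀ {A B} → A ≈D B → B ≈D A
  ≈D-sym (≈D-intro p pw) with PwD-↭ (PwD-sym pw) (↭-sym p)
  ... | X , q , pw' = ≈D-intro q pw'

  PwD-sym : ∀ {A B} → PwD A B → PwD B A
  PwD-sym [] = []
  PwD-sym (e ∷ pw) = ≈I-sym e ∷ PwD-sym pw

≈C-refl : ∀ {n} (Γ : Ctx n) → Γ ≈C Γ
≈C-refl [] = []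
≈C-refl (𝓜 ∷ Γ) = ≈I-refl 𝓜 ∷ ≈C-refl Γ

≈C-sym : ∀ {n} {Γ Δ : Ctx n} → Γ ≈C Δ → Δ ≈C Γ
≈C-sym [] = []
≈C-sym (e ∷ es) = ≈I-sym e ∷ ≈C-sym es

PwI-scale : ∀ q {A B} → PwI A B → PwI (scaleI q A) (scaleI q B)
PwI-scale q [] = []
PwI-scale q (e ∷ pw) = e ∷ PwI-scale q pw

≈I-scale : ∀ q {A B} → A ≈I B → scaleI q A ≈I scaleI q B
≈I-scale q (≈I-intro p pw) = ≈I-intro (map⁺ _ p) (PwI-scale q pw)

PwD-scale : ∀ q {A B} → PwD A B → PwD (scaleD q A) (scaleD q B)
PwD-scale q [] = []
PwD-scale q (e ∷ pw) = e ∷ PwD-scale q pw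

≈D-scale : ∀ q {A B} → A ≈D B → scaleD q A ≈D scaleD q B
≈D-scale q (≈D-intro p pw) = ≈D-intro (map⁺ _ p) (PwD-scale q pw)

PwI-++ : ∀ {A B C D} → PwI A B → PwI C D → PwI (A ++ C) (B ++ D)
PwI-++ [] q = q
PwI-++ (e ∷ p) q = e ∷ PwI-++ p q

≈I-++ : ∀ {A B C D} → A ≈I B → C ≈I D → (A ++ C) ≈I (B ++ D)
≈I-++ (≈I-intro p pw) (≈I-intro q qw) = ≈I-intro (++⁺ p q) (PwI-++ pw qw)

PwD-++ : ∀ {A B C D} → PwD A B → PwD C D → PwD (A ++ C) (B ++ D)
PwD-++ [] q = q
PwD-++ (e ∷ p) q = e ∷ PwD-++ p q

≈D-++ : ∀ {A B C D} → A ≈D B → C ≈D D → (A ++ C) ≈D (B ++ D)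
≈D-++ (≈D-intro p pw) (≈D-intro q qw) = ≈D-intro (++⁺ p q) (PwD-++ pw qw)

↭→≈I : ∀ {A B} → A ↭ B → A ≈I B
↭→≈I {B = B} p = ≈I-intro p (PwI-refl B)

≈C-scale : ∀ {n} q {Γ Δ : Ctx n} → Γ ≈C Δ → (q ·C Γ) ≈C (q ·C Δ)
≈C-scale q [] = []
≈C-scale q (e ∷ es) = ≈I-scale q e ∷ ≈C-scale q es

≈C-⊎ : ∀ {n} {Γ Γ' Δ Δ' : Ctx n} → Γ ≈C Γ' → Δ ≈C Δ' → (Γ ⊎C Δ) ≈C (Γ' ⊎C Δ')
≈C-⊎ [] [] = []
≈C-⊎ (e ∷ es) (f ∷ fs) = ≈I-++ e f ∷ ≈C-⊎ es fs

≈C-upd : ∀ {n} (x : Fin n) {𝓜 𝓜'} → 𝓜 ≈I 𝓜' → (∅ [ x ]≔ 𝓜) ≈C (∅ [ x ]≔ 𝓜')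
≈C-upd {suc n} zero e = e ∷ ≈C-refl _
≈C-upd {suc n} (suc x) e = ≈I-refl [] ∷ ≈C-upd x e

C* : ∀ {n} → Ctx n → Ctx n → Set
C* = Star _≈C_

C*-scale : ∀ {n} q {Γ Δ : Ctx n} → C* Γ Δ → C* (q ·C Γ) (q ·C Δ)
C*-scale q = gmap (q ·C_) (≈C-scale q)

C*-⊎ : ∀ {n} {Γ Γ' Δ Δ' : Ctx n} → C* Γ Γ' → C* Δ Δ' → C* (Γ ⊎C Δ) (Γ' ⊎C Δ')
C*-⊎ {Γ' = Γ'} {Δ = Δ} s t = gmap (_⊎C Δ) (λ e → ≈C-⊎ e (≈C-refl Δ)) s ◅◅ gmap (Γ' ⊎C_) (λ e → ≈C-⊎ (≈C-refl Γ') e) t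

C*-split : ∀ {n} {𝓜 𝓝} {Γ Δ : Ctx n} → C* (𝓜 ∷ Γ) (𝓝 ∷ Δ) → Star _≈I_ 𝓜 𝓝 × C* Γ Δ
C*-split ε = ε , ε
C*-split ((e ∷ es) ◅ s) with C*-split s
... | a , b = e ◅ a , es ◅ b

I*-sym : ∀ {𝓜 𝓝} → Star _≈I_ 𝓜 𝓝 → Star _≈I_ 𝓝 𝓜
I*-sym = reverse ≈I-sym

⊎-idˡ : ∀ {n} (Γ : Ctx n) → ∅ ⊎C Γ ≡ Γ
⊎-idˡ [] = refl
⊎-idˡ (𝓜 ∷ Γ) = cong (𝓜 ∷_) (⊎-idˡ Γ)

⊎-idʳ : ∀ {n} (Γ : Ctx n) → Γ ⊎C ∅ ≡ Γ
⊎-idʳ [] = refl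
⊎-idʳ (𝓜 ∷ Γ) = cong₂ _∷_ (List.++-identityʳ 𝓜) (⊎-idʳ Γ)

⊎-assoc : ∀ {n} (Γ Δ Θ : Ctx n) → (Γ ⊎C Δ) ⊎C Θ ≡ Γ ⊎C (Δ ⊎C Θ)
⊎-assoc [] [] [] = refl
⊎-assoc (a ∷ Γ) (b ∷ Δ) (c ∷ Θ) = cong₂ _∷_ (List.++-assoc a b c) (⊎-assoc Γ Δ Θ)

·-⊎ : ∀ {n} q (Γ Δ : Ctx n) → q ·C (Γ ⊎C Δ) ≡ (q ·C Γ) ⊎C (q ·C Δ)
·-⊎ q [] [] = refl
·-⊎ q (a ∷ Γ) (b ∷ Δ) = cong₂ _∷_ (scale-++ q a b) (·-⊎ q Γ Δ)

·-∅ : ∀ {n} q → q ·C (∅ {n}) ≡ ∅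
·-∅ {zero} q = refl
·-∅ {suc n} q = cong ([] ∷_) (·-∅ {n} q)

·-· : ∀ {n} q q' (Γ : Ctx n) → q ·C (q' ·C Γ) ≡ (q * q') ·C Γ
·-· q q' [] = refl
·-· q q' (a ∷ Γ) = cong₂ _∷_ (scale-scale q q' a) (·-· q q' Γ)

1·C : ∀ {n} (Γ : Ctx n) → 1ℚ ·C Γ ≡ Γ
1·C [] = refl
1·C (a ∷ Γ) = cong₂ _∷_ (scale-1 a) (1·C Γ)

·-upd : ∀ {n} q (x : Fin n) 𝓜 → q ·C (∅ [ x ]≔ 𝓜) ≡ ∅ [ x ]≔ scaleI q 𝓜
·-upd {suc n} q zero 𝓜 = cong (scaleI q 𝓜 ∷_) (·-∅ {n} q)
·-upd {suc n} q (suc x) 𝓜 = cong ([] ∷_) (·-upd q x 𝓜)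

upd-⊎ : ∀ {n} (x : Fin n) 𝓜 𝓝 → (∅ [ x ]≔ 𝓜) ⊎C (∅ [ x ]≔ 𝓝) ≡ ∅ [ x ]≔ (𝓜 ++ 𝓝)
upd-⊎ {suc n} zero 𝓜 𝓝 = cong ((𝓜 ++ 𝓝) ∷_) (⊎-idˡ ∅)
upd-⊎ {suc n} (suc x) 𝓜 𝓝 = cong ([] ∷_) (upd-⊎ x 𝓜 𝓝)

upd-[] : ∀ {n} (x : Fin n) → ∅ [ x ]≔ [] ≡ ∅
upd-[] {suc n} zero = refl
upd-[] {suc n} (suc x) = cong ([] ∷_) (upd-[] x)

⊎C-interchange : ∀ {n} (A B C D : Ctx n) → ((A ⊎C B) ⊎C (C ⊎C D)) ≈C ((A ⊎C C) ⊎C (B ⊎C D))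
⊎C-interchange [] [] [] [] = []
⊎C-interchange (a ∷ A) (b ∷ B) (c ∷ C) (d ∷ D) = ↭→≈I (p a b c d) ∷ ⊎C-interchange A B C D
  where
    p : ∀ (a b c d : Inter) → (a ++ b) ++ (c ++ d) ↭ (a ++ c) ++ (b ++ d)
    p a b c d = ↭-trans (↭-reflexive (List.++-assoc a b (c ++ d)))
      (↭-trans (++⁺ˡ a (shifts b c))
        (↭-reflexive (sym (List.++-assoc a c (b ++ d)))))

-- Working under d binders: insertCtx d 𝓜 puts the assumption 𝓜 at position hole d,
-- punch d renames the other variables around it, and substAt d V substitutes V for it.
insertCtx : ∀ d {n} → Inter → Ctx (d +ℕ n) → Ctx (d +ℕ suc n)
insertCtx zero 𝓜 Γ = 𝓜 ∷ Γ
insertCtx (suc d) 𝓜 (𝓝 ∷ Γ) = 𝓝 ∷ insertCtx d 𝓜 Γ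

weakenCtx : ∀ d {n} → Ctx n → Ctx (d +ℕ n)
weakenCtx zero Γ = Γ
weakenCtx (suc d) Γ = [] ∷ weakenCtx d Γ

punch : ∀ d {n} → Fin (d +ℕ n) → Fin (d +ℕ suc n)
punch zero = suc
punch (suc d) = extR (punch d)

hole : ∀ d {n} → Fin (d +ℕ suc n)
hole zero = zero
hole (suc d) = suc (hole d)

weakenV : ∀ d {n} → Val n → Val (d +ℕ n)
weakenV zero V = V
weakenV (suc d) V = renV suc (weakenV d V)

substAt : ∀ d {n} → Val n → Fin (d +ℕ suc n) → Val (d +ℕ n)
substAt zero V = single V
substAt (suc d) V = extS (substAt d V)

insertCtx-⊎ : ∀ d {n} 𝓜a 𝓜b (Γa Γb : Ctx (d +ℕ n)) →
  insertCtx d (𝓜a ++ 𝓜b) (Γa ⊎C Γb) ≡ insertCtx d 𝓜a Γa ⊎C insertCtx d 𝓜b Γb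
insertCtx-⊎ zero 𝓜a 𝓜b Γa Γb = refl
insertCtx-⊎ (suc d) 𝓜a 𝓜b (a ∷ Γa) (b ∷ Γb) = cong ((a ++ b) ∷_) (insertCtx-⊎ d 𝓜a 𝓜b Γa Γb)

insertCtx-· : ∀ d {n} q 𝓜 (Γ : Ctx (d +ℕ n)) → insertCtx d (scaleI q 𝓜) (q ·C Γ) ≡ q ·C insertCtx d 𝓜 Γ
insertCtx-· zero q 𝓜 Γ = refl
insertCtx-· (suc d) q 𝓜 (a ∷ Γ) = cong (scaleI q a ∷_) (insertCtx-· d q 𝓜 Γ)

insertCtx-∅ : ∀ d {n} → insertCtx d {n} [] ∅ ≡ ∅
insertCtx-∅ zero = refl
insertCtx-∅ (suc d) = cong ([] ∷_) (insertCtx-∅ d)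

insertCtx-hole : ∀ d {n} 𝓝 → insertCtx d {n} 𝓝 ∅ ≡ ∅ [ hole d ]≔ 𝓝
insertCtx-hole zero 𝓝 = refl
insertCtx-hole (suc d) 𝓝 = cong ([] ∷_) (insertCtx-hole d 𝓝)

insertCtx-punch : ∀ d {n} (j : Fin (d +ℕ n)) 𝓝 → insertCtx d [] (∅ [ j ]≔ 𝓝) ≡ ∅ [ punch d j ]≔ 𝓝
insertCtx-punch zero j 𝓝 = refl
insertCtx-punch (suc d) zero 𝓝 = cong (𝓝 ∷_) (insertCtx-∅ d)
insertCtx-punch (suc d) (suc j) 𝓝 = cong ([] ∷_) (insertCtx-punch d j 𝓝)

weakenCtx-⊎ : ∀ d {n} (Γ Δ : Ctx n) → weakenCtx d (Γ ⊎C Δ) ≡ weakenCtx d Γ ⊎C weakenCtx d Δ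
weakenCtx-⊎ zero Γ Δ = refl
weakenCtx-⊎ (suc d) Γ Δ = cong ([] ∷_) (weakenCtx-⊎ d Γ Δ)

weakenCtx-· : ∀ d {n} q (Γ : Ctx n) → weakenCtx d (q ·C Γ) ≡ q ·C weakenCtx d Γ
weakenCtx-· zero q Γ = refl
weakenCtx-· (suc d) q Γ = cong ([] ∷_) (weakenCtx-· d q Γ)

weakenCtx-∅ : ∀ d {n} → weakenCtx d (∅ {n}) ≡ ∅
weakenCtx-∅ zero = refl
weakenCtx-∅ (suc d) = cong ([] ∷_) (weakenCtx-∅ d)

substAt-var : ∀ d {n} (V : Val n) (j : Fin (d +ℕ suc n)) →
  ((j ≡ hole d) × (substAt d V j ≡ weakenV d V)) ⊎ (Σ (Fin (d +ℕ n)) λ j' → (j ≡ punch d j') × (substAt d V j ≡ var j'))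
substAt-var zero V zero = inj₁ (refl , refl)
substAt-var zero V (suc j) = inj₂ (j , refl , refl)
substAt-var (suc d) V zero = inj₂ (zero , refl , refl)
substAt-var (suc d) V (suc j) with substAt-var d V j
... | inj₁ (refl , e) = inj₁ (refl , cong (renV suc) e)
... | inj₂ (j' , refl , e) = inj₂ (suc j' , refl , cong (renV suc) e)

InUnit-* : ∀ {p q} → InUnit p → InUnit q → InUnit (p * q)
InUnit-* {p} {q} (p>0 , p≤1) (q>0 , q≤1) =
  positive⁻¹ (p * q) {{pos*pos⇒pos p {{positive p>0}} q {{positive q>0}}}} ,
  ≤-trans (≤-respʳ-≡ (*-monoˡ-≤-nonNeg′ (<⇒≤ p>0) q≤1) (*-identityʳ p)) p≤1

InUnit-1 : InUnit 1ℚ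
InUnit-1 = positive⁻¹ 1ℚ , ≤-refl

InUnit-½ : InUnit ½
InUnit-½ = positive⁻¹ ½ , *≤* (+≤+ (s≤s z≤n))

WFC : ∀ {n} → Ctx n → Set
WFC [] = ⊤
WFC (𝓜 ∷ Γ) = WFI 𝓜 × WFC Γ

WFI-++ : ∀ {A B} → WFI A → WFI B → WFI (A ++ B)
WFI-++ [] b = b
WFI-++ (x ∷ a) b = x ∷ WFI-++ a b

WFI-scale : ∀ {q A} → InUnit q → WFI A → WFI (scaleI q A)
WFI-scale h [] = []
WFI-scale h ((u , a) ∷ w) = (InUnit-* h u , a) ∷ WFI-scale h w

WFD'-++ : ∀ {A B} → WFD' A → WFD' B → WFD' (A ++ B)
WFD'-++ [] b = b
WFD'-++ (x ∷ a) b = x ∷ WFD'-++ a b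

WFD'-scale : ∀ {q A} → InUnit q → WFD' A → WFD' (scaleD q A)
WFD'-scale h [] = []
WFD'-scale h ((u , a) ∷ w) = (InUnit-* h u , a) ∷ WFD'-scale h w

mass-PwD : ∀ {A B} → PwD A B → ‖ A ‖ ≡ ‖ B ‖
mass-PwD [] = refl
mass-PwD (_∷_ {p = p} e pw) = cong (p +_) (mass-PwD pw)

WFI-↭ : ∀ {A B} → A ↭ B → WFI A → WFI B
WFI-↭ ↭-refl w = w
WFI-↭ (↭-prep _ p) (x ∷ w) = x ∷ WFI-↭ p w
WFI-↭ (↭-swap _ _ p) (x ∷ y ∷ w) = y ∷ x ∷ WFI-↭ p w
WFI-↭ (↭-trans p q) w = WFI-↭ q (WFI-↭ p w)

WFD'-↭ : ∀ {A B} → A ↭ B → WFD' A → WFD' B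
WFD'-↭ ↭-refl w = w
WFD'-↭ (↭-prep _ p) (x ∷ w) = x ∷ WFD'-↭ p w
WFD'-↭ (↭-swap _ _ p) (x ∷ y ∷ w) = y ∷ x ∷ WFD'-↭ p w
WFD'-↭ (↭-trans p q) w = WFD'-↭ q (WFD'-↭ p w)

mutual
  WFA-≈ : ∀ {A B} → A ≈A B → WFA A → WFA B
  WFA-≈ (≈⇒ i d) (wf⇒ a b) = wf⇒ (WFI-≈ i a) (WFD-≈ d b)

  WFI-≈ : ∀ {A B} → A ≈I B → WFI A → WFI B
  WFI-≈ (≈I-intro p pw) w = WFI-Pw pw (WFI-↭ p w)

  WFI-Pw : ∀ {A B} → PwI A B → WFI A → WFI B
  WFI-Pw [] w = w
  WFI-Pw (e ∷ pw) ((u , a) ∷ w) = (u , WFA-≈ e a) ∷ WFI-Pw pw w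

  WFD-≈ : ∀ {A B} → A ≈D B → WFD A → WFD B
  WFD-≈ (≈D-intro p pw) (wfd w n) = wfd (WFD'-Pw pw (WFD'-↭ p w))
      (≤-respˡ-≡ (trans (sym (mass-PwD pw)) (sym (mass-↭ p))) n)

  WFD'-Pw : ∀ {A B} → PwD A B → WFD' A → WFD' B
  WFD'-Pw [] w = w
  WFD'-Pw (e ∷ pw) ((u , a) ∷ w) = (u , WFI-≈ e a) ∷ WFD'-Pw pw w

WFC-≈ : ∀ {n} {Γ Δ : Ctx n} → Γ ≈C Δ → WFC Γ → WFC Δ
WFC-≈ [] w = tt
WFC-≈ (e ∷ es) (a , w) = WFI-≈ e a , WFC-≈ es w

WFC-⊎ : ∀ {n} {Γ Δ : Ctx n} → WFC Γ → WFC Δ → WFC (Γ ⊎C Δ)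
WFC-⊎ {Γ = []} {[]} a b = tt
WFC-⊎ {Γ = _ ∷ _} {_ ∷ _} (a , w) (b , v) = WFI-++ a b , WFC-⊎ w v

WFC-scale : ∀ {n q} {Γ : Ctx n} → InUnit q → WFC Γ → WFC (q ·C Γ)
WFC-scale {Γ = []} h w = tt
WFC-scale {Γ = _ ∷ _} h (a , w) = WFI-scale h a , WFC-scale h w

WFC-∅ : ∀ {n} → WFC (∅ {n})
WFC-∅ {zero} = tt
WFC-∅ {suc n} = [] , WFC-∅ {n}

WFC-upd : ∀ {n} (x : Fin n) {𝓜} → WFI 𝓜 → WFC (∅ [ x ]≔ 𝓜)
WFC-upd {suc n} zero w = w , WFC-∅ {n}
WFC-upd {suc n} (suc x) w = [] , WFC-upd x w


mutual
  wf-⊢A : ∀ {n} {Γ : Ctx n} {w V A} → Γ ⊢A[ w ] V ∶ A → WFC Γ × WFA A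
  wf-⊢A (⊢λ d) with wf-⊢ d
  ... | (a , c) , wd = c , wf⇒ a wd
  wf-⊢A (convA d eC eA) with wf-⊢A d
  ... | c , a = WFC-≈ eC c , WFA-≈ eA a

  wf-⊢I : ∀ {n} {Γ : Ctx n} {w V 𝓜} → Γ ⊢I[ w ] V ∶ 𝓜 → WFC Γ × WFI 𝓜
  wf-⊢I (⊢var {x} wi) = WFC-upd x wi , wi
  wf-⊢I (⊢! b) = wf-Bang b
  wf-⊢I (convI d eC eI) with wf-⊢I d
  ... | c , a = WFC-≈ eC c , WFI-≈ eI a

  wf-Bang : ∀ {n} {Γ : Ctx n} {w V 𝓜} → Bang Γ w V 𝓜 → WFC Γ × WFI 𝓜
  wf-Bang {n} [] = WFC-∅ {n} , []
  wf-Bang (cons q h d b) with wf-⊢A d | wf-Bang b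
  ... | c , a | c' , i = WFC-⊎ (WFC-scale h c) c' , (h , a) ∷ i

  wf-⊢ : ∀ {n} {Γ : Ctx n} {w M a} → Γ ⊢[ w ] M ∶ a → WFC Γ × WFD a
  wf-⊢ {n} ⊢zero = WFC-∅ {n} , wfd [] 0≤1
  wf-⊢ (⊢app dV dW) with wf-⊢I dV | wf-⊢I dW
  ... | c , ((_ , wf⇒ _ wb) ∷ []) | c' , _ = WFC-⊎ c c' , wb
  wf-⊢ (⊢⊕ {a = a} {b = b} dM dN) with wf-⊢ dM | wf-⊢ dN
  ... | c , wfd wa na | c' , wfd wb nb =
    WFC-⊎ (WFC-scale InUnit-½ c) (WFC-scale InUnit-½ c') ,
    wfd (WFD'-++ (WFD'-scale InUnit-½ wa) (WFD'-scale InUnit-½ wb))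
        (≤-respˡ-≡ (trans (mass-++ (scaleD ½ a) (scaleD ½ b)) (cong₂ _+_ (mass-scale ½ a) (mass-scale ½ b)))
          (+-mono-≤ (*-monoˡ-≤-nonNeg′ 0≤½ na) (*-monoˡ-≤-nonNeg′ 0≤½ nb)))
  wf-⊢ (⊢let dN lb) with wf-⊢ dN
  ... | c , wfd wa na with wf-LetBodies lb wa
  ... | c' , wb , nb = WFC-⊎ c c' , wfd wb (≤-trans nb na)
  wf-⊢ (⊢val d) with wf-⊢I d
  ... | c , a = c , wfd ((InUnit-1 , a) ∷ []) ≤-refl
  wf-⊢ (convT d eC eD) with wf-⊢ d
  ... | c , a = WFC-≈ eC c , WFD-≈ eD a

  wf-LetBodies : ∀ {n} {M : Tm (suc n)} {a Δ w b} → LetBodies M a Δ w b → WFD' a → WFC Δ × WFD' b × (‖ b ‖ ≤ ‖ a ‖)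
  wf-LetBodies {n} [] w = WFC-∅ {n} , [] , ≤-refl
  wf-LetBodies (cons {p} {𝓜} {a} {Δ} {Δ'} {w} {w'} {b} {b'} d rest) ((hp , _) ∷ wa) with wf-⊢ d | wf-LetBodies rest wa
  ... | (_ , c) , wfd wb nb | c' , wb' , nb' =
    WFC-⊎ (WFC-scale hp c) c' , WFD'-++ (WFD'-scale hp wb) wb' ,
    ≤-respˡ-≡ (trans (mass-++ (scaleD p b) b') (cong (_+ ‖ b' ‖) (mass-scale p b)))
      (+-mono-≤ (≤-respʳ-≡ (*-monoˡ-≤-nonNeg′ (<⇒≤ (proj₁ hp)) nb) (*-identityʳ p)) nb')

module _ {n : ℕ} where
  castI : ∀ {Γ Γ' : Ctx n} {w w' V 𝓜 𝓜'} → Γ ≡ Γ' → w ≡ w' → 𝓜 ≡ 𝓜' → Γ ⊢I[ w ] V ∶ 𝓜 → Γ' ⊢I[ w' ] V ∶ 𝓜'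
  castI refl refl refl d = d
  castB : ∀ {Γ Γ' : Ctx n} {w w' V 𝓜 𝓜'} → Γ ≡ Γ' → w ≡ w' → 𝓜 ≡ 𝓜' → Bang Γ w V 𝓜 → Bang Γ' w' V 𝓜'
  castB refl refl refl d = d
  castT : ∀ {Γ Γ' : Ctx n} {w w' M a a'} → Γ ≡ Γ' → w ≡ w' → a ≡ a' → Γ ⊢[ w ] M ∶ a → Γ' ⊢[ w' ] M ∶ a'
  castT refl refl refl d = d
  castL : ∀ {M : Tm (suc n)} {a Δ Δ' w w' b b'} → Δ ≡ Δ' → w ≡ w' → b ≡ b' →
    LetBodies M a Δ w b → LetBodies M a Δ' w' b'
  castL refl refl refl d = d

¬⊢A-var : ∀ {n} {Γ : Ctx n} {w x A} → Γ ⊢A[ w ] var x ∶ A → ⊥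
¬⊢A-var (convA d _ _) = ¬⊢A-var d

Bang-++ : ∀ {n} {Γa Γb : Ctx n} {wa wb V 𝓜a 𝓜b} → Bang Γa wa V 𝓜a → Bang Γb wb V 𝓜b →
  Bang (Γa ⊎C Γb) (wa + wb) V (𝓜a ++ 𝓜b)
Bang-++ {Γb = Γb} {wb = wb} [] bb = castB (sym (⊎-idˡ Γb)) (sym (+-identityˡ wb)) refl bb
Bang-++ {Γb = Γb} {wb = wb} (cons {Γ} {Γ'} {w} {w'} q h d ba) bb =
  castB (sym (⊎-assoc (q ·C Γ) Γ' Γb)) (sym (+-assoc (q * w) w' wb)) refl (cons q h d (Bang-++ ba bb))

⊢I-++ : ∀ {n} {Θa Θb : Ctx n} {ua ub V 𝓜a 𝓜b} → Θa ⊢I[ ua ] V ∶ 𝓜a → Θb ⊢I[ ub ] V ∶ 𝓜b →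
  (Θa ⊎C Θb) ⊢I[ ua + ub ] V ∶ (𝓜a ++ 𝓜b)
⊢I-++ (⊢var {x} {𝓜a} wa) (⊢var {𝓜 = 𝓜b} wb) = castI (sym (upd-⊎ x 𝓜a 𝓜b)) refl refl (⊢var (WFI-++ wa wb))
⊢I-++ (⊢var {x} {𝓜a} wa) (⊢! []) = castI (sym (⊎-idʳ _)) refl (sym (List.++-identityʳ 𝓜a)) (⊢var wa)
⊢I-++ (⊢var wa) (⊢! (cons q h d b)) = ⊥-elim (¬⊢A-var d)
⊢I-++ (⊢! []) (⊢var wb) = castI (sym (⊎-idˡ _)) refl refl (⊢var wb)
⊢I-++ (⊢! (cons q h d b)) (⊢var wb) = ⊥-elim (¬⊢A-var d)
⊢I-++ (⊢! ba) (⊢! bb) = ⊢! (Bang-++ ba bb)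
⊢I-++ {Θb = Θb} {𝓜b = 𝓜b} (convI d eC eI) db = convI (⊢I-++ d db) (≈C-⊎ eC (≈C-refl Θb)) (≈I-++ eI (≈I-refl 𝓜b))
⊢I-++ {Θa = Θa} {𝓜a = 𝓜a} da@(⊢var _) (convI d eC eI) = convI (⊢I-++ da d)
    (≈C-⊎ (≈C-refl Θa) eC) (≈I-++ (≈I-refl 𝓜a) eI)
⊢I-++ {Θa = Θa} {𝓜a = 𝓜a} da@(⊢! _) (convI d eC eI) = convI (⊢I-++ da d) (≈C-⊎ (≈C-refl Θa) eC) (≈I-++ (≈I-refl 𝓜a) eI)

Bang-scale : ∀ {n} {q} {Γ : Ctx n} {w V 𝓜} → InUnit q → Bang Γ w V 𝓜 → Bang (q ·C Γ) (q * w) V (scaleI q 𝓜)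
Bang-scale {n} {q} h [] = castB (sym (·-∅ {n} q)) (sym (*-zeroʳ q)) refl []
Bang-scale {q = q} h (cons {Γ} {Γ'} {w} {w'} q' h' d b) =
  castB (trans (cong (_⊎C (q ·C Γ')) (sym (·-· q q' Γ))) (sym (·-⊎ q (q' ·C Γ) Γ'))) (*-+-assoc q q' w w') refl
    (cons (q * q') (InUnit-* h h') d (Bang-scale h b))

⊢I-scale : ∀ {n} {q} {Θ : Ctx n} {u V 𝓜} → InUnit q → Θ ⊢I[ u ] V ∶ 𝓜 → (q ·C Θ) ⊢I[ q * u ] V ∶ scaleI q 𝓜
⊢I-scale {q = q} h (⊢var {x} {𝓜} wi) = castI (sym (·-upd q x 𝓜)) (sym (*-zeroʳ q)) refl (⊢var (WFI-scale h wi))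
⊢I-scale h (⊢! b) = ⊢! (Bang-scale h b)
⊢I-scale {q = q} h (convI d eC eI) = convI (⊢I-scale h d) (≈C-scale q eC) (≈I-scale q eI)

⊢I-var-inv : ∀ {n} {Θ : Ctx n} {u x 𝓜} → Θ ⊢I[ u ] var x ∶ 𝓜 → (u ≡ 0ℚ) × C* Θ (∅ [ x ]≔ 𝓜)
⊢I-var-inv (⊢var wi) = refl , ε
⊢I-var-inv {x = x} (⊢! []) = refl , ≡⇒Star _ (sym (upd-[] x))
⊢I-var-inv (⊢! (cons q h d b)) = ⊥-elim (¬⊢A-var d)
⊢I-var-inv {x = x} (convI d eC eI) with ⊢I-var-inv d
... | e , ch = e , (≈C-sym eC ◅ (ch ◅◅ (≈C-upd x eI ◅ ε)))

convT-C* : ∀ {n} {Γ Γ' : Ctx n} {w M a} → C* Γ Γ' → Γ ⊢[ w ] M ∶ a → Γ' ⊢[ w ] M ∶ a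
convT-C* ε d = d
convT-C* {a = a} (e ◅ s) d = convT-C* s (convT d e (≈D-refl a))

convT-D* : ∀ {n} {Γ : Ctx n} {w M a a'} → Star _≈D_ a a' → Γ ⊢[ w ] M ∶ a → Γ ⊢[ w ] M ∶ a'
convT-D* ε d = d
convT-D* {Γ = Γ} (e ◅ s) d = convT-D* s (convT d (≈C-refl Γ) e)

convA-src* : ∀ {n} {Γ : Ctx n} {w V 𝓜 𝓜' b} → Star _≈I_ 𝓜 𝓜' → Γ ⊢A[ w ] V ∶ (𝓜 ⇒ b) → Γ ⊢A[ w ] V ∶ (𝓜' ⇒ b)
convA-src* ε d = d
convA-src* {Γ = Γ} {b = b} (e ◅ s) d = convA-src* s (convA d (≈C-refl Γ) (≈⇒ e (≈D-refl b)))

infixl 4 _◅≡_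
_◅≡_ : ∀ {n} {Γ Δ Δ' : Ctx n} → C* Γ Δ → Δ ≡ Δ' → C* Γ Δ'
s ◅≡ refl = s

consC* : ∀ {n} 𝓜 {Γ Δ : Ctx n} → C* Γ Δ → C* (𝓜 ∷ Γ) (𝓜 ∷ Δ)
consC* 𝓜 = gmap (𝓜 ∷_) (λ e → ≈I-refl 𝓜 ∷ e)

headC* : ∀ {n} {𝓜 𝓝} (Γ : Ctx n) → Star _≈I_ 𝓜 𝓝 → C* (𝓜 ∷ Γ) (𝓝 ∷ Γ)
headC* Γ = gmap (_∷ Γ) (λ e → e ∷ ≈C-refl Γ)

Strengthened : ∀ d {n} → Ctx (d +ℕ suc n) → (Ctx (d +ℕ n) → Set) → Set
Strengthened d {n} Θ J = Σ (Ctx (d +ℕ n)) λ Γ' → J Γ' × C* Θ (insertCtx d [] Γ')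

strengthen-zero : ∀ d {n} {M : Tm (d +ℕ n)} → Strengthened d ∅ (λ Γ' → Γ' ⊢[ 0ℚ ] M ∶ [])
strengthen-zero d = ∅ , ⊢zero , ≡⇒Star _ (sym (insertCtx-∅ d))

strengthen-conv : ∀ {d n} {Θ Θ' : Ctx (d +ℕ suc n)} {w} {M : Tm (d +ℕ n)} {a a'} → Θ' ≈C Θ → a ≈D a' →
                  Strengthened d Θ' (λ Γ' → Γ' ⊢[ w ] M ∶ a) → Strengthened d Θ (λ Γ' → Γ' ⊢[ w ] M ∶ a')
strengthen-conv eC eD (Γ' , d' , ch) = Γ' , convT d' (≈C-refl Γ') eD , (≈C-sym eC ◅ ch)

-- A variable that does not occur in a term can only be assigned [ ], so it can be dropped.
mutual
  strengthenI : ∀ d {n} {Θ : Ctx (d +ℕ suc n)} {w} {W : Val (d +ℕ n)} {𝓝} → Θ ⊢I[ w ] renV (punch d) W ∶ 𝓝 →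
                Strengthened d Θ (λ Γ' → Γ' ⊢I[ w ] W ∶ 𝓝)
  strengthenI d {W = var j} {𝓝} dd with ⊢I-var-inv dd
  ... | e , ch = ∅ [ j ]≔ 𝓝 , castI refl (sym e) refl (⊢var (proj₂ (wf-⊢I dd))) , (ch ◅≡ sym (insertCtx-punch d j 𝓝))
  strengthenI d {W = lam Q} (⊢! b) with strengthenBang d b
  ... | Γ' , b' , ch = Γ' , ⊢! b' , ch
  strengthenI d {W = lam Q} {𝓝} (convI dd eC eI) with strengthenI d dd
  ... | Γ' , d' , ch = Γ' , convI d' (≈C-refl Γ') eI , (≈C-sym eC ◅ ch)

  strengthenBang : ∀ d {n} {Θ : Ctx (d +ℕ suc n)} {w} {W : Val (d +ℕ n)} {𝓝} → Bang Θ w (renV (punch d) W) 𝓝 →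
                   Strengthened d Θ (λ Γ' → Bang Γ' w W 𝓝)
  strengthenBang d [] = ∅ , [] , ≡⇒Star _ (sym (insertCtx-∅ d))
  strengthenBang d (cons {Γ} {Γ'} q h dA b) with strengthenA d dA | strengthenBang d b
  ... | Γa , dA' , cha | Γb , b' , chb = (q ·C Γa) ⊎C Γb , cons q h dA' b' ,
    (C*-⊎ (C*-scale q cha) chb ◅≡ trans (cong (_⊎C insertCtx d [] Γb) (sym (insertCtx-· d q [] Γa)))
        (sym (insertCtx-⊎ d [] [] (q ·C Γa) Γb)))

  strengthenA : ∀ d {n} {Θ : Ctx (d +ℕ suc n)} {w} {W : Val (d +ℕ n)} {A} → Θ ⊢A[ w ] renV (punch d) W ∶ A →
                Strengthened d Θ (λ Γ' → Γ' ⊢A[ w ] W ∶ A)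
  strengthenA d {W = var j} dd = ⊥-elim (¬⊢A-var dd)
  strengthenA d {W = lam Q} (⊢λ {b = b} dQ) with strengthenT (suc d) dQ
  ... | 𝓝' ∷ Γ'' , dQ' , ch with C*-split ch
  ... | hd , tl = Γ'' , convA-src* (I*-sym hd) (⊢λ dQ') , tl
  strengthenA d {W = lam Q} (convA dd eC eA) with strengthenA d dd
  ... | Γ' , d' , ch = Γ' , convA d' (≈C-refl Γ') eA , (≈C-sym eC ◅ ch)

  strengthenT : ∀ d {n} {Θ : Ctx (d +ℕ suc n)} {w} {M : Tm (d +ℕ n)} {a} → Θ ⊢[ w ] renT (punch d) M ∶ a →
                Strengthened d Θ (λ Γ' → Γ' ⊢[ w ] M ∶ a)
  strengthenT d {M = val W} ⊢zero = strengthen-zero d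
  strengthenT d {M = app V W} ⊢zero = strengthen-zero d
  strengthenT d {M = M1 ⊕ M2} ⊢zero = strengthen-zero d
  strengthenT d {M = lett N M'} ⊢zero = strengthen-zero d
  strengthenT d {M = val W} (convT dd eC eD) = strengthen-conv eC eD (strengthenT d dd)
  strengthenT d {M = app V W} (convT dd eC eD) = strengthen-conv eC eD (strengthenT d dd)
  strengthenT d {M = M1 ⊕ M2} (convT dd eC eD) = strengthen-conv eC eD (strengthenT d dd)
  strengthenT d {M = lett N M'} (convT dd eC eD) = strengthen-conv eC eD (strengthenT d dd)
  strengthenT d {M = val W} (⊢val dd) with strengthenI d dd
  ... | Γ' , d' , ch = Γ' , ⊢val d' , ch
  strengthenT d {M = app V W} (⊢app dV dW) with strengthenI d dV | strengthenI d dW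
  ... | Γa , dV' , cha | Γb , dW' , chb = Γa ⊎C Γb , ⊢app dV' dW' , (C*-⊎ cha chb ◅≡ sym (insertCtx-⊎ d [] [] Γa Γb))
  strengthenT d {M = M1 ⊕ M2} (⊢⊕ dM dN) with strengthenT d dM | strengthenT d dN
  ... | Γa , dM' , cha | Γb , dN' , chb = (½ ·C Γa) ⊎C (½ ·C Γb) , ⊢⊕ dM' dN' ,
    (C*-⊎ (C*-scale ½ cha) (C*-scale ½ chb)
       ◅≡ trans (cong₂ _⊎C_ (sym (insertCtx-· d ½ [] Γa)) (sym (insertCtx-· d ½ [] Γb)))
                (sym (insertCtx-⊎ d [] [] (½ ·C Γa) (½ ·C Γb))))
  strengthenT d {M = lett N M'} (⊢let dN lb) with strengthenT d dN | strengthenLet d lb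
  ... | Γa , dN' , cha | Γb , lb' , chb = Γa ⊎C Γb , ⊢let dN' lb' , (C*-⊎ cha chb ◅≡ sym (insertCtx-⊎ d [] [] Γa Γb))

  strengthenLet : ∀ d {n} {M : Tm (suc (d +ℕ n))} {a} {Δ : Ctx (d +ℕ suc n)} {w b} →
    LetBodies (renT (punch (suc d)) M) a Δ w b →
                  Strengthened d Δ (λ Δ' → LetBodies M a Δ' w b)
  strengthenLet d [] = ∅ , [] , ≡⇒Star _ (sym (insertCtx-∅ d))
  strengthenLet d (cons {p} {𝓜} dB rest) with strengthenT (suc d) dB | strengthenLet d rest
  ... | 𝓜' ∷ Γ1 , dB' , ch | Δr , rest' , chr with C*-split ch
  ... | hd , tl = (p ·C Γ1) ⊎C Δr , cons (convT-C* (headC* Γ1 (I*-sym hd)) dB') rest' ,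
    (C*-⊎ (C*-scale p tl) chr ◅≡ trans (cong (_⊎C insertCtx d [] Δr) (sym (insertCtx-· d p [] Γ1)))
        (sym (insertCtx-⊎ d [] [] (p ·C Γ1) Δr)))

strengthen-weakenV : ∀ d {n} {Θ : Ctx (d +ℕ n)} {w} {V : Val n} {𝓝} → Θ ⊢I[ w ] weakenV d V ∶ 𝓝 →
      Σ (Ctx n) λ Γ2 → (Γ2 ⊢I[ w ] V ∶ 𝓝) × C* Θ (weakenCtx d Γ2)
strengthen-weakenV zero dd = _ , dd , ε
strengthen-weakenV (suc d) dd with strengthenI zero dd
... | Γ' , d' , ch with strengthen-weakenV d d'
... | Γ2 , d2 , ch2 = Γ2 , d2 , (ch ◅◅ consC* [] ch2)

-- Anti-substitution

-- The occurrences of the substituted value V in P{V/x} may each be typed differently; their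
-- intersection types, scaled as in the derivation, are collected into the type 𝓜 of x.
record Split (d : ℕ) {n : ℕ} (Θ : Ctx (d +ℕ n)) (w : ℚ) (V : Val n) (J : Ctx (d +ℕ suc n) → ℚ → Set) : Set where
  constructor mkS
  field
    𝓜 : Inter
    Γ1 : Ctx (d +ℕ n)
    Γ2 : Ctx n
    w1 w2 : ℚ
    der : J (insertCtx d 𝓜 Γ1) w1
    vder : Γ2 ⊢I[ w2 ] V ∶ 𝓜
    ch : C* Θ (Γ1 ⊎C weakenCtx d Γ2)
    le : w ≤ w1 + w2

module _ {d n : ℕ} {V : Val n} where
  Split-zero : ∀ {J : Ctx (d +ℕ suc n) → ℚ → Set} → J ∅ 0ℚ → Split d ∅ 0ℚ V J
  Split-zero {J} j = mkS [] ∅ ∅ 0ℚ 0ℚ (subst (λ Γ → J Γ 0ℚ) (sym (insertCtx-∅ d)) j) (⊢! [])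
    (≡⇒Star _ (sym (trans (cong (∅ ⊎C_) (weakenCtx-∅ d)) (⊎-idˡ ∅)))) ≤-refl

  Split-map : ∀ {Θ w} {J J' : Ctx (d +ℕ suc n) → ℚ → Set} → (∀ {Γ x} → J Γ x → J' Γ x) →
    Split d Θ w V J → Split d Θ w V J'
  Split-map f (mkS 𝓜 Γ1 Γ2 w1 w2 der vder ch le) = mkS 𝓜 Γ1 Γ2 w1 w2 (f der) vder ch le

  Split-conv : ∀ {Θ Θ' w} {J : Ctx (d +ℕ suc n) → ℚ → Set} → Θ' ≈C Θ → Split d Θ' w V J → Split d Θ w V J
  Split-conv e (mkS 𝓜 Γ1 Γ2 w1 w2 der vder ch le) = mkS 𝓜 Γ1 Γ2 w1 w2 der vder (≈C-sym e ◅ ch) le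

  Split-cast : ∀ {Θ Θ' w w'} {J : Ctx (d +ℕ suc n) → ℚ → Set} → Θ ≡ Θ' → w ≡ w' → Split d Θ w V J → Split d Θ' w' V J
  Split-cast refl refl s = s

  Split-combine : ∀ {Θa Θb wa wb} {Ja Jb J : Ctx (d +ℕ suc n) → ℚ → Set} (qa qb c : ℚ) → InUnit qa → InUnit qb →
          Split d Θa wa V Ja → Split d Θb wb V Jb →
          (∀ {Γa Γb xa xb} → Ja Γa xa → Jb Γb xb → J ((qa ·C Γa) ⊎C (qb ·C Γb)) (qa * xa + qb * xb + c)) →
          Split d ((qa ·C Θa) ⊎C (qb ·C Θb)) (qa * wa + qb * wb + c) V J
  Split-combine {Θa} {Θb} {wa} {wb} {J = J} qa qb c ha hb (mkS 𝓜a Γ1a Γ2a w1a w2a dera vdera cha lea)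
      (mkS 𝓜b Γ1b Γ2b w1b w2b derb vderb chb leb) rule =
    mkS (scaleI qa 𝓜a ++ scaleI qb 𝓜b) ((qa ·C Γ1a) ⊎C (qb ·C Γ1b)) ((qa ·C Γ2a) ⊎C (qb ·C Γ2b))
      (qa * w1a + qb * w1b + c) (qa * w2a + qb * w2b)
      (subst (λ Γ → J Γ (qa * w1a + qb * w1b + c)) eΓ (rule dera derb))
      (⊢I-++ (⊢I-scale ha vdera) (⊢I-scale hb vderb))
      ((C*-⊎ (C*-scale qa cha) (C*-scale qb chb) ◅≡ e1) ◅◅
          (⊎C-interchange (qa ·C Γ1a) (weakenCtx d (qa ·C Γ2a)) (qb ·C Γ1b) (weakenCtx d (qb ·C Γ2b)) ◅ ε) ◅≡ e2)
      le
    where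
      eΓ : (qa ·C insertCtx d 𝓜a Γ1a) ⊎C (qb ·C insertCtx d 𝓜b Γ1b) ≡ insertCtx d (scaleI qa 𝓜a ++ scaleI qb 𝓜b) ((qa ·C Γ1a) ⊎C (qb ·C Γ1b))
      eΓ = trans (cong₂ _⊎C_ (sym (insertCtx-· d qa 𝓜a Γ1a)) (sym (insertCtx-· d qb 𝓜b Γ1b)))
          (sym (insertCtx-⊎ d (scaleI qa 𝓜a) (scaleI qb 𝓜b) (qa ·C Γ1a) (qb ·C Γ1b)))
      e1 : (qa ·C (Γ1a ⊎C weakenCtx d Γ2a)) ⊎C (qb ·C (Γ1b ⊎C weakenCtx d Γ2b)) ≡ ((qa ·C Γ1a) ⊎C weakenCtx d (qa ·C Γ2a)) ⊎C ((qb ·C Γ1b) ⊎C weakenCtx d (qb ·C Γ2b))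
      e1 = cong₂ _⊎C_ (trans (·-⊎ qa Γ1a (weakenCtx d Γ2a)) (cong ((qa ·C Γ1a) ⊎C_) (sym (weakenCtx-· d qa Γ2a))))
                      (trans (·-⊎ qb Γ1b (weakenCtx d Γ2b)) (cong ((qb ·C Γ1b) ⊎C_) (sym (weakenCtx-· d qb Γ2b))))
      e2 : ((qa ·C Γ1a) ⊎C (qb ·C Γ1b)) ⊎C (weakenCtx d (qa ·C Γ2a) ⊎C weakenCtx d (qb ·C Γ2b)) ≡ ((qa ·C Γ1a) ⊎C (qb ·C Γ1b)) ⊎C weakenCtx d ((qa ·C Γ2a) ⊎C (qb ·C Γ2b))
      e2 = cong (((qa ·C Γ1a) ⊎C (qb ·C Γ1b)) ⊎C_) (sym (weakenCtx-⊎ d (qa ·C Γ2a) (qb ·C Γ2b)))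
      le : qa * wa + qb * wb + c ≤ (qa * w1a + qb * w1b + c) + (qa * w2a + qb * w2b)
      le = ≤-trans
        (+-monoˡ-≤ c (+-mono-≤ (*-monoˡ-≤-nonNeg′ (<⇒≤ (proj₁ ha)) lea) (*-monoˡ-≤-nonNeg′ (<⇒≤ (proj₁ hb)) leb)))
        (≤-reflexive (shuffle qa qb c w1a w2a w1b w2b))
        where
        shuffle : ∀ qa qb c w1a w2a w1b w2b →
                  qa * (w1a + w2a) + qb * (w1b + w2b) + c ≡ (qa * w1a + qb * w1b + c) + (qa * w2a + qb * w2b)
        shuffle = solve-∀ ringℚ

Split-tail : ∀ {d n} {V : Val n} {𝓝} {Γ : Ctx (d +ℕ n)} {w} {J : Ctx (suc d +ℕ suc n) → ℚ → Set} →
  Split (suc d) (𝓝 ∷ Γ) w V J → Split d Γ w V (λ Γ' x → Σ Inter λ 𝓝' → J (𝓝' ∷ Γ') x × Star _≈I_ 𝓝' 𝓝)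
Split-tail (mkS 𝓜 (𝓝' ∷ Γ1') Γ2 w1 w2 der vder ch le) with C*-split ch
... | hd , tl = mkS 𝓜 Γ1' Γ2 w1 w2 (𝓝' , der , (≡⇒Star _ (sym (List.++-identityʳ 𝓝')) ◅◅ I*-sym hd)) vder tl le

mutual
  antisubstI : ∀ d {n} {V : Val n} {Θ : Ctx (d +ℕ n)} {w} {W : Val (d +ℕ suc n)} {𝓝} →
        Θ ⊢I[ w ] subV (substAt d V) W ∶ 𝓝 → Split d Θ w V (λ Γ x → Γ ⊢I[ x ] W ∶ 𝓝)
  antisubstI d {V = V} {W = var j} dd with substAt-var d V j
  antisubstI d {V = V} {Θ} {w} {var j} {𝓝} dd | inj₁ (refl , e) with strengthen-weakenV d
      (subst (λ z → Θ ⊢I[ w ] z ∶ 𝓝) e dd)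
  ... | Γ2 , d2 , chh =
    mkS 𝓝 ∅ Γ2 0ℚ w (castI (sym (insertCtx-hole d 𝓝)) refl refl (⊢var (proj₂ (wf-⊢I dd)))) d2
      (chh ◅≡ sym (⊎-idˡ (weakenCtx d Γ2))) (≤-reflexive (sym (+-identityˡ w)))
  antisubstI d {V = V} {Θ} {w} {var j} {𝓝} dd | inj₂ (j' , refl , e) with ⊢I-var-inv
      (subst (λ z → Θ ⊢I[ w ] z ∶ 𝓝) e dd)
  ... | ew , chv =
    mkS [] (∅ [ j' ]≔ 𝓝) ∅ 0ℚ 0ℚ (castI (sym (insertCtx-punch d j' 𝓝)) refl refl (⊢var (proj₂ (wf-⊢I dd)))) (⊢! [])
      (chv ◅≡ sym (trans (cong ((∅ [ j' ]≔ 𝓝) ⊎C_) (weakenCtx-∅ d)) (⊎-idʳ _))) (≤-reflexive ew)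
  antisubstI d {W = lam Q} (⊢! b) = Split-map ⊢! (antisubstBang d b)
  antisubstI d {W = lam Q} (convI dd eC eI) = Split-conv eC
      (Split-map (λ {Γ} x → convI x (≈C-refl Γ) eI) (antisubstI d dd))

  antisubstBang : ∀ d {n} {V : Val n} {Θ : Ctx (d +ℕ n)} {w} {Q : Tm (suc (d +ℕ suc n))} {𝓝} →
        Bang Θ w (lam (subT (substAt (suc d) V) Q)) 𝓝 → Split d Θ w V (λ Γ x → Bang Γ x (lam Q) 𝓝)
  antisubstBang d [] = Split-zero []
  antisubstBang d {Q = Q} (cons {Γ} {Γ'} {w} {w'} {A = A} {𝓜 = 𝓜} q h dA b) =
    Split-cast (cong ((q ·C Γ) ⊎C_) (1·C Γ'))
        (trans (cong₂ _+_ (cong (q * w +_) (*-identityˡ w')) refl) (+-identityʳ (q * w + w')))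
      (Split-combine q 1ℚ 0ℚ h InUnit-1 (antisubstA d dA) (antisubstBang d b)
        (λ {Γa} {Γb} {xa} {xb} da db → castB (cong ((q ·C Γa) ⊎C_) (sym (1·C Γb)))
            (trans (cong (q * xa +_) (sym (*-identityˡ xb))) (sym (+-identityʳ _))) refl (cons q h da db)))

  antisubstA : ∀ d {n} {V : Val n} {Θ : Ctx (d +ℕ n)} {w} {Q : Tm (suc (d +ℕ suc n))} {A} →
        Θ ⊢A[ w ] lam (subT (substAt (suc d) V) Q) ∶ A → Split d Θ w V (λ Γ x → Γ ⊢A[ x ] lam Q ∶ A)
  antisubstA d {V = V} {Q = Q} (⊢λ {Γ} {𝓝} {w} {M} {b} dQ) with Split-tail (antisubstT (suc d) dQ)
  ... | mkS 𝓜 Γ1 Γ2 w1 w2 (𝓝' , der , chI) vder ch le =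
    mkS 𝓜 Γ1 Γ2 (w1 + 1ℚ) w2 (convA-src* chI (⊢λ der)) vder ch
      (≤-respʳ-≡ (+-monoˡ-≤ 1ℚ le) (shuffle w1 w2))
    where shuffle : ∀ a b → a + b + 1ℚ ≡ a + 1ℚ + b
          shuffle = solve-∀ ringℚ
  antisubstA d (convA dd eC eA) = Split-conv eC (Split-map (λ {Γ} x → convA x (≈C-refl Γ) eA) (antisubstA d dd))

  antisubstT : ∀ d {n} {V : Val n} {Θ : Ctx (d +ℕ n)} {w} {P : Tm (d +ℕ suc n)} {a} →
        Θ ⊢[ w ] subT (substAt d V) P ∶ a → Split d Θ w V (λ Γ x → Γ ⊢[ x ] P ∶ a)
  antisubstT d {P = val W} ⊢zero = Split-zero ⊢zero
  antisubstT d {P = app V' W} ⊢zero = Split-zero ⊢zero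
  antisubstT d {P = M1 ⊕ M2} ⊢zero = Split-zero ⊢zero
  antisubstT d {P = lett N M} ⊢zero = Split-zero ⊢zero
  antisubstT d {P = val W} (convT dd eC eD) = Split-conv eC
      (Split-map (λ {Γ} x → convT x (≈C-refl Γ) eD) (antisubstT d dd))
  antisubstT d {P = app V' W} (convT dd eC eD) = Split-conv eC
      (Split-map (λ {Γ} x → convT x (≈C-refl Γ) eD) (antisubstT d dd))
  antisubstT d {P = M1 ⊕ M2} (convT dd eC eD) = Split-conv eC
      (Split-map (λ {Γ} x → convT x (≈C-refl Γ) eD) (antisubstT d dd))
  antisubstT d {P = lett N M} (convT dd eC eD) = Split-conv eC
      (Split-map (λ {Γ} x → convT x (≈C-refl Γ) eD) (antisubstT d dd))
  antisubstT d {P = val W} (⊢val dd) = Split-map ⊢val (antisubstI d dd)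
  antisubstT d {P = app V' W} (⊢app {Γ} {Δ} {w} {v} dV dW) =
    Split-cast (cong₂ _⊎C_ (1·C Γ) (1·C Δ)) (trans (+-identityʳ _) (cong₂ _+_ (*-identityˡ w) (*-identityˡ v)))
      (Split-combine 1ℚ 1ℚ 0ℚ InUnit-1 InUnit-1 (antisubstI d dV) (antisubstI d dW)
        (λ {Γa} {Γb} {xa} {xb} da db → castT (sym (cong₂ _⊎C_ (1·C Γa) (1·C Γb)))
            (sym (trans (+-identityʳ _) (cong₂ _+_ (*-identityˡ xa) (*-identityˡ xb)))) refl (⊢app da db)))
  antisubstT d {P = M1 ⊕ M2} (⊢⊕ dM dN) = Split-combine ½ ½ 1ℚ InUnit-½ InUnit-½ (antisubstT d dM)
      (antisubstT d dN) (λ da db → ⊢⊕ da db)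
  antisubstT d {P = lett N M} (⊢let {Γ} {Δ} {v} {w} {a = a} dN lb) with wf-⊢ dN
  ... | _ , wfd wa _ =
    Split-cast (cong₂ _⊎C_ (1·C Γ) (1·C Δ))
        (trans (cong (_+ 1ℚ) (cong₂ _+_ (*-identityˡ v) (*-identityˡ w))) (cong (_+ 1ℚ) (+-comm v w)))
      (Split-combine 1ℚ 1ℚ 1ℚ InUnit-1 InUnit-1 (antisubstT d dN) (antisubstLet d lb wa)
        (λ {Γa} {Γb} {xa} {xb} da db → castT (sym (cong₂ _⊎C_ (1·C Γa) (1·C Γb)))
           (sym (trans (cong (_+ 1ℚ) (cong₂ _+_ (*-identityˡ xa) (*-identityˡ xb)))
               (cong (_+ 1ℚ) (+-comm xa xb)))) refl (⊢let da db)))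

  antisubstLet : ∀ d {n} {V : Val n} {M : Tm (suc (d +ℕ suc n))} {a} {Δ : Ctx (d +ℕ n)} {w b} →
        LetBodies (subT (substAt (suc d) V) M) a Δ w b → WFD' a → Split d Δ w V (λ Γ x → LetBodies M a Γ x b)
  antisubstLet d [] _ = Split-zero []
  antisubstLet d {M = M} (cons {p} {𝓜} {a} {Δ} {Δ'} {w} {w'} {b} {b'} dB rest) ((hp , _) ∷ wa) =
    Split-cast (cong ((p ·C Δ) ⊎C_) (1·C Δ')) (trans (+-identityʳ _) (cong (p * w +_) (*-identityˡ w')))
      (Split-combine p 1ℚ 0ℚ hp InUnit-1
          (Split-map (λ {Γ} (𝓝' , der , chI) → convT-C* (headC* Γ chI) der) (Split-tail (antisubstT (suc d) dB)))
              (antisubstLet d rest wa)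
        (λ {Γa} {Γb} {xa} {xb} da db → castL (cong ((p ·C Γa) ⊎C_) (sym (1·C Γb)))
            (sym (trans (+-identityʳ _) (cong (p * xa +_) (*-identityˡ xb)))) refl (cons da db)))

-- Subject expansion and completeness

Ctx0-[] : (Γ : Ctx 0) → Γ ≡ []
Ctx0-[] [] = refl

antisubst-closed : ∀ {Θ : Ctx 0} {w} {P : Tm 1} {V : Val 0} {a} → Θ ⊢[ w ] P [ V ] ∶ a →
      Σ Inter λ 𝓜 → Σ ℚ λ w1 → Σ ℚ λ w2 → ((𝓜 ∷ []) ⊢[ w1 ] P ∶ a) × ([] ⊢I[ w2 ] V ∶ 𝓜) × (w ≤ w1 + w2)
antisubst-closed d with antisubstT zero d
... | mkS 𝓜 [] [] w1 w2 der vder ch le = 𝓜 , w1 , w2 , der , vder , le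

data Fam : MDist → ℚ → Dist → Set where
  [] : Fam [] 0ℚ []
  cons : ∀ {p X w a L W b} → [] ⊢[ w ] X ∶ a → Fam L W b → Fam ((p , X) ∷ L) (p * w + W) (scaleD p a ++ b)

Fam-cast : ∀ {L W W' b b'} → W ≡ W' → b ≡ b' → Fam L W b → Fam L W' b'
Fam-cast refl refl f = f

Fam-split : ∀ L1 {L2 W b} → Fam (L1 ++ L2) W b →
  Σ ℚ λ W1 → Σ ℚ λ W2 → Σ Dist λ b1 → Σ Dist λ b2 → Fam L1 W1 b1 × Fam L2 W2 b2 × (W ≡ W1 + W2) × (b ≡ b1 ++ b2)
Fam-split [] {W = W} {b} f = 0ℚ , W , [] , b , [] , f , sym (+-identityˡ W) , refl
Fam-split (x ∷ L1) (cons {p} {X} {w} {a} d f) with Fam-split L1 f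
... | W1 , W2 , b1 , b2 , f1 , f2 , refl , refl =
  p * w + W1 , W2 , scaleD p a ++ b1 , b2 , cons d f1 , f2 ,
  sym (+-assoc (p * w) W1 W2) , sym (List.++-assoc (scaleD p a) b1 b2)

Fam-unscale : ∀ p L {W b} → Fam (scaleM p L) W b → Σ ℚ λ W' → Σ Dist λ b' →
  Fam L W' b' × (W ≡ p * W') × (b ≡ scaleD p b')
Fam-unscale p [] [] = 0ℚ , [] , [] , sym (*-zeroʳ p) , refl
Fam-unscale p ((q , X) ∷ L) (cons {w = w} {a = a} d f) with Fam-unscale p L f
... | W' , b' , f' , refl , refl = q * w + W' , scaleD q a ++ b' , cons d f' , *-+-assoc p q w W' ,
  trans (cong (_++ scaleD p b') (sym (scale-scale p q a))) (sym (scale-++ p (scaleD q a) b'))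

⊢let-inv : ∀ {Θ : Ctx 0} {w N P a} → Θ ⊢[ w ] lett N P ∶ a →
  Σ ℚ λ v → Σ Dist λ a' → Σ ℚ λ w' → Σ Dist λ b' →
  ([] ⊢[ v ] N ∶ a') × LetBodies P a' [] w' b' × Star _≈D_ b' a × (w ≤ w' + v + 1ℚ)
⊢let-inv ⊢zero = 0ℚ , [] , 0ℚ , [] , ⊢zero , [] , ε , 0≤1
⊢let-inv (⊢let {Γ} {Δ} {v} {w} {a = a'} {b = b} dN lb) =
  v , a' , w , b , castT (Ctx0-[] Γ) refl refl dN , castL (Ctx0-[] Δ) refl refl lb , ε , ≤-refl
⊢let-inv (convT d eC eD) with ⊢let-inv d
... | v , a' , w' , b' , dN , lb , ch , le = v , a' , w' , b' , dN , lb , ch ◅◅ (eD ◅ ε) , le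

LetBodies-scale : ∀ q {P : Tm 1} {a Δ w b} → LetBodies P a Δ w b → LetBodies P (scaleD q a) [] (q * w) (scaleD q b)
LetBodies-scale q [] = castL refl (sym (*-zeroʳ q)) refl []
LetBodies-scale q (cons {p} {𝓜} {a} {Δ} {Δ'} {w} {w'} {b} {b'} d rest) =
  castL refl (*-+-assoc q p w w')
      (trans (cong (_++ scaleD q b') (sym (scale-scale q p b))) (sym (scale-++ q (scaleD p b) b')))
    (cons (castT (cong (𝓜 ∷_) (Ctx0-[] Δ)) refl refl d) (LetBodies-scale q rest))

LetBodies-++ : ∀ {P : Tm 1} {a a2 Δ Δ2 w w2 b b2} → LetBodies P a Δ w b → LetBodies P a2 Δ2 w2 b2 →
  LetBodies P (a ++ a2) [] (w + w2) (b ++ b2)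
LetBodies-++ {Δ2 = Δ2} {w2 = w2} [] lb2 = castL (Ctx0-[] Δ2) (sym (+-identityˡ w2)) refl lb2
LetBodies-++ {w2 = w2} {b2 = b2} (cons {p} {𝓜} {a} {Δ} {Δ'} {w} {w'} {b} {b'} d rest) lb2 =
  castL refl (sym (+-assoc (p * w) w' w2)) (sym (List.++-assoc (scaleD p b) b' b2))
    (cons (castT (cong (𝓜 ∷_) (Ctx0-[] Δ)) refl refl d) (LetBodies-++ rest lb2))

D*-scale : ∀ q {a b} → Star _≈D_ a b → Star _≈D_ (scaleD q a) (scaleD q b)
D*-scale q = gmap (scaleD q) (≈D-scale q)

D*-++ : ∀ {a b c d} → Star _≈D_ a b → Star _≈D_ c d → Star _≈D_ (a ++ c) (b ++ d)
D*-++ {b = b} {c = c} s t = gmap (_++ c) (λ e → ≈D-++ e (≈D-refl c)) s ◅◅ gmap (b ++_) (λ e → ≈D-++ (≈D-refl b) e) t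

Fam-let-inv : ∀ (P : Tm 1) L {W b} → NonNeg L → Fam (map (letE P) L) W b →
  Σ ℚ λ V' → Σ Dist λ A' → Σ ℚ λ W' → Σ Dist λ B' →
  Fam L V' A' × LetBodies P A' [] W' B' × Star _≈D_ B' b × (W ≤ W' + V' + mass L)
Fam-let-inv P [] [] [] = 0ℚ , [] , 0ℚ , [] , [] , [] , ε , ≤-refl
Fam-let-inv P ((q , N1) ∷ L) (hq ∷ pos) (cons {w = w} {a = a} d f) with ⊢let-inv d | Fam-let-inv P L pos f
... | v , a' , w' , b' , dN , lb , ch , le | V'r , A'r , W'r , B'r , fr , lbr , chr , ler =
  q * v + V'r , scaleD q a' ++ A'r , q * w' + W'r , scaleD q b' ++ B'r ,
  cons dN fr , LetBodies-++ (LetBodies-scale q lb) lbr , D*-++ (D*-scale q ch) chr ,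
  ≤-trans (+-mono-≤ (*-monoˡ-≤-nonNeg′ hq le) ler) (≤-reflexive (shuffle q w' v W'r V'r (mass L)))
  where shuffle : ∀ q w' v W V m → q * (w' + v + 1ℚ) + (W + V + m) ≡ (q * w' + W) + (q * v + V) + (q + m)
        shuffle = solve-∀ ringℚ

mutual
  subjectExpansion : ∀ X {W b} → NonValue X → Fam (lift1 X) W b → Σ ℚ λ w → ([] ⊢[ w ] X ∶ b) × (1ℚ + W ≤ w)
  subjectExpansion (app (var ()) W') nv f
  subjectExpansion (app (lam P) W') nv (cons {w = w} {a = a} d []) with antisubst-closed d
  ... | 𝓜 , w1 , w2 , d1 , d2 , le =
    (1ℚ * (w1 + 1ℚ) + 0ℚ) + w2 ,
    castT refl refl (sym (trans (List.++-identityʳ (scaleD 1ℚ a)) (scale-1 a)))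
        (⊢app (⊢! (cons 1ℚ InUnit-1 (⊢λ d1) [])) d2) ,
    ≤-respʳ-≡ (≤-respˡ-≡ (shuffle₀ w) (+-monoʳ-≤ 1ℚ le)) (shuffle₁ w1 w2)
    where shuffle₀ : ∀ w → 1ℚ + (1ℚ * w + 0ℚ) ≡ 1ℚ + w
          shuffle₀ = solve-∀ ringℚ
          shuffle₁ : ∀ a b → 1ℚ + (a + b) ≡ (1ℚ * (a + 1ℚ) + 0ℚ) + b
          shuffle₁ = solve-∀ ringℚ
  subjectExpansion (M1 ⊕ M2) nv (cons {w = w1} {a = a1} d1 (cons {w = w2} {a = a2} d2 [])) =
    ½ * w1 + ½ * w2 + 1ℚ ,
    castT refl refl (cong (scaleD ½ a1 ++_) (sym (List.++-identityʳ (scaleD ½ a2)))) (⊢⊕ d1 d2) ,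
    ≤-reflexive (shuffle ½ w1 w2)
    where shuffle : ∀ h a b → 1ℚ + (h * a + (h * b + 0ℚ)) ≡ h * a + h * b + 1ℚ
          shuffle = solve-∀ ringℚ
  subjectExpansion (lett (val V) P) nv (cons {w = w} {a = a} d []) with antisubst-closed d
  ... | 𝓜 , w1 , w2 , d1 , d2 , le =
    (1ℚ * w1 + 0ℚ) + w2 + 1ℚ , ⊢let (⊢val d2) (cons {p = 1ℚ} d1 []) ,
    ≤-respʳ-≡ (≤-respˡ-≡ (shuffle₀ w) (+-monoʳ-≤ 1ℚ le)) (shuffle₁ w1 w2)
    where shuffle₀ : ∀ w → 1ℚ + (1ℚ * w + 0ℚ) ≡ 1ℚ + w
          shuffle₀ = solve-∀ ringℚ
          shuffle₁ : ∀ a b → 1ℚ + (a + b) ≡ (1ℚ * a + 0ℚ) + b + 1ℚ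
          shuffle₁ = solve-∀ ringℚ
  subjectExpansion (lett (app V W') P) nv f = subjectExpansion-let (app V W') P _ f
  subjectExpansion (lett (N1 ⊕ N2) P) nv f = subjectExpansion-let (N1 ⊕ N2) P _ f
  subjectExpansion (lett (lett N1 N2) P) nv f = subjectExpansion-let (lett N1 N2) P _ f

  subjectExpansion-let : ∀ N P (nv : NonValue N) {W b} → Fam (map (letE P) (lift1 N)) W b → Σ ℚ λ w →
    ([] ⊢[ w ] lett N P ∶ b) × (1ℚ + W ≤ w)
  subjectExpansion-let N P nv {W} f with Fam-let-inv P (lift1 N) (NonNeg-lift1 N) f
  ... | V' , A' , W' , B' , fN , lb , ch , le with subjectExpansion N nv fN
  ... | v , dN , lev = W' + v + 1ℚ , convT-D* ch (⊢let dN lb) ,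
    ≤-trans (+-monoʳ-≤ 1ℚ (≤-trans le (≤-reflexive (cong (W' + V' +_) (mass-lift1 N)))))
      (≤-trans (≤-reflexive (shuffle W' V')) (+-monoˡ-≤ 1ℚ (+-monoʳ-≤ W' lev)))
    where shuffle : ∀ W V → 1ℚ + (W + V + 1ℚ) ≡ W + (1ℚ + V) + 1ℚ
          shuffle = solve-∀ ringℚ

Fam-expand-stepM : ∀ L {W b} → NonNeg L → Fam (stepM L) W b → Σ ℚ λ W' → Fam L W' b × (W + nonvalMass L ≤ W')
Fam-expand-stepM [] [] [] = 0ℚ , [] , ≤-refl
Fam-expand-stepM ((p , X) ∷ L) {W} (hp ∷ pos) f with Fam-split (scaleM p (lift1 X)) f
... | W1 , W2 , b1 , b2 , f1 , f2 , refl , refl with Fam-unscale p (lift1 X) f1 | Fam-expand-stepM L pos f2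
... | W1' , b1' , f1' , refl , refl | W2' , f2' , le2 = entry X f1'
  where
    expanded : ∀ w → 1ℚ + W1' ≤ w → p * W1' + W2 + (p + nonvalMass L) ≤ p * w + W2'
    expanded w le = ≤-trans (≤-reflexive (shuffle p W1' W2 (nonvalMass L))) (+-mono-≤ (*-monoˡ-≤-nonNeg′ hp le) le2)
      where shuffle : ∀ p a b c → p * a + b + (p + c) ≡ p * (1ℚ + a) + (b + c)
            shuffle = solve-∀ ringℚ
    entry : ∀ X → Fam (lift1 X) W1' b1' → Σ ℚ λ W' →
      Fam ((p , X) ∷ L) W' (scaleD p b1' ++ b2) × (p * W1' + W2 + nonvalMass ((p , X) ∷ L) ≤ W')
    entry (val V) (cons {w = w} {a = a} d []) =
      p * w + W2' , Fam-cast refl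
          (cong (_++ b2) (cong (scaleD p) (sym (trans (List.++-identityʳ (scaleD 1ℚ a)) (scale-1 a))))) (cons d f2') ,
      ≤-trans (≤-reflexive (shuffle p w W2 (nonvalMass L))) (+-monoʳ-≤ (p * w) le2)
      where shuffle : ∀ p w a b → p * (1ℚ * w + 0ℚ) + a + (0ℚ + b) ≡ p * w + (a + b)
            shuffle = solve-∀ ringℚ
    entry (app V' W') f' with subjectExpansion (app V' W') tt f'
    ... | w , d , le = p * w + W2' , cons d f2' , expanded w le
    entry (M1 ⊕ M2) f' with subjectExpansion (M1 ⊕ M2) tt f'
    ... | w , d , le = p * w + W2' , cons d f2' , expanded w le
    entry (lett N P) f' with subjectExpansion (lett N P) tt f'
    ... | w , d , le = p * w + W2' , cons d f2' , expanded w le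

Fam-expand-steps : ∀ k L {W b} → NonNeg L → Fam (steps k L) W b → Σ ℚ λ W' → Fam L W' b × (W + runtime k L ≤ W')
Fam-expand-steps zero L {W} pos f = W , f , ≤-reflexive (+-identityʳ W)
Fam-expand-steps (suc k) L {W} pos f with Fam-expand-stepM (steps k L) (NonNeg-steps k pos) f
... | W1 , f1 , le1 with Fam-expand-steps k L pos f1
... | W' , f' , le' = W' , f' ,
  ≤-trans (≤-reflexive (trans (cong (W +_) (runtime-suc k L)) (shuffle W (runtime k L) (nonvalMass (steps k L)))))
      (≤-trans (+-monoˡ-≤ (runtime k L) le1) le')
  where shuffle : ∀ a b c → a + (b + c) ≡ (a + c) + b
        shuffle = solve-∀ ringℚ

Fam-tight : ∀ L → Σ ℚ λ W → Σ Dist λ b → Fam L W b × Tight b × (‖ b ‖ ≡ valMass L) × (0ℚ ≤ W)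
Fam-tight [] = 0ℚ , [] , [] , [] , refl , ≤-refl
Fam-tight ((p , X) ∷ L) with Fam-tight L
... | W , b , f , t , ‖b‖≡ , 0≤W = entry X
  where
  0≤p*0+W : 0ℚ ≤ p * 0ℚ + W
  0≤p*0+W = ≤-respʳ-≡ 0≤W (sym (trans (cong (_+ W) (*-zeroʳ p)) (+-identityˡ W)))
  nonvalue : ∀ X → NonValue X →
             Σ ℚ λ W' → Σ Dist λ b' → Fam ((p , X) ∷ L) W' b' × Tight b' × (‖ b' ‖ ≡ valMass ((p , X) ∷ L)) × (0ℚ ≤ W')
  nonvalue X nv = p * 0ℚ + W , _ , cons ⊢zero f , t ,
    trans ‖b‖≡ (sym (trans (cong (_+ valMass L) (valProb-nonValue p X nv)) (+-identityˡ _))) , 0≤p*0+W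
  entry : ∀ X → Σ ℚ λ W' → Σ Dist λ b' →
    Fam ((p , X) ∷ L) W' b' × Tight b' × (‖ b' ‖ ≡ valMass ((p , X) ∷ L)) × (0ℚ ≤ W')
  entry (val V) = p * 0ℚ + W , _ , cons (⊢val (⊢! [])) f , refl ∷ t , cong₂ _+_ (*-identityʳ p) ‖b‖≡ , 0≤p*0+W
  entry (app V' W') = nonvalue (app V' W') tt
  entry (M₁ ⊕ M₂) = nonvalue (M₁ ⊕ M₂) tt
  entry (lett N P) = nonvalue (lett N P) tt

completeness : ∀ k M → Σ ℚ λ w → Σ Dist λ a → Tight a × ([] ⊢[ w ] M ∶ a) × (Pk k M ≤ ‖ a ‖) × (Ek k M ≤ w)
completeness k M with Fam-tight (steps k ((1ℚ , M) ∷ []))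
... | W , b , f , t , ‖b‖≡ , 0≤W with Fam-expand-steps k ((1ℚ , M) ∷ []) (0≤1 ∷ []) f
... | _ , cons {w = w} {a = a} d [] , W+E≤ = w , a , subst Tight b≡a t , d , Pk≤‖a‖ , Ek≤w
  where
  b≡a : scaleD 1ℚ a ++ [] ≡ a
  b≡a = trans (List.++-identityʳ (scaleD 1ℚ a)) (scale-1 a)
  Pk≤‖a‖ : Pk k M ≤ ‖ a ‖
  Pk≤‖a‖ = ≤-reflexive (trans (cong valMass (mdist-steps k M)) (trans (sym ‖b‖≡) (cong ‖_‖ b≡a)))
  Ek≤w : Ek k M ≤ w
  Ek≤w = begin
    Ek k M                  ≡⟨ Ek≡runtime k M ⟩
    runtime k _             ≡⟨ +-identityˡ _ ⟨
    0ℚ + runtime k _        ≤⟨ +-monoˡ-≤ (runtime k ((1ℚ , M) ∷ [])) 0≤W ⟩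
    W + runtime k _         ≤⟨ W+E≤ ⟩
    1ℚ * w + 0ℚ             ≡⟨ trans (+-identityʳ (1ℚ * w)) (*-identityˡ w) ⟩
    w                       ∎
    where open ≤-Reasoning

mainTheorem11 : (M : Tm 0) →
    SameSup (PSeq M) (TightNorms M) × SameSup (ESeq M) (TightWeights M)
mainTheorem11 M = (P≤norms , norms≤P) , (E≤weights , weights≤E)
  where
  P≤norms : SupLe (PSeq M) (TightNorms M)
  P≤norms _ (k , refl) r r<Pk with completeness k M
  ... | w , a , t , d , Pk≤‖a‖ , _ = ‖ a ‖ , (w , a , t , d , refl) , <-≤-trans r<Pk Pk≤‖a‖

  norms≤P : SupLe (TightNorms M) (PSeq M)
  norms≤P _ (w , a , t , d , refl) r r<‖a‖ with soundness M t d
  ... | k , ‖a‖≤Pk , _ = Pk k M , (k , refl) , <-≤-trans r<‖a‖ ‖a‖≤Pk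

  E≤weights : SupLe (ESeq M) (TightWeights M)
  E≤weights _ (k , refl) r r<Ek with completeness k M
  ... | w , a , t , d , _ , Ek≤w = w , (a , t , d) , <-≤-trans r<Ek Ek≤w

  weights≤E : SupLe (TightWeights M) (ESeq M)
  weights≤E w (a , t , d) r r<w with soundness M t d
  ... | k , _ , w≤Ek = Ek k M , (k , refl) , <-≤-trans r<w w≤Ek
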